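{- Let $n,k,m,r$ be positive integers with $r\le k\le m$. Then: (i) $N(n,k,m;r)\geq rn$. (ii) $N(n,k,m;r)\geq N(n,k,m;i)$ for every $i\in [r-1]=\{1,\dots,r-1\}$. (iii) $\frac{1}{r}N(rn,k,m)\leq N(n,k,m;r)\leq N(rn,k,m)$. (iv) $N(n,k,m;r)\leq rN\left(n,\left\lceil\frac{k}{r}\right\rceil,\left\lfloor\frac{m}{r}\right\rfloor\right)$. (v) If $r\leq k-1$, then for every integer $c\in[r,k-1]$, $$N(n,k,m;r)\geq nc-\left\lfloor\frac{k-c}{m-k+1}\left[\frac{\left\lfloor\frac{k-1}{r}\right\rfloor{m\choose k-1}}{{m-c\choose k-1-c}}-n\right]\right\rfloor.$$
   Context: An $(n,N,k,m;r)$ multiset combinatorial batch code (MCBC) is a collection $\mathcal C=\{C_1,\dots,C_m\}$ of subsets of $[n]=\{1,\dots,n\}$ (servers) with $N=\sum_{j=1}^m|C_j|$, such that for every multiset request $\{i_1,\dots,i_k\}$ of $k$ elements of $[n]$ in which every element has multiplicity at most $r$, there exist subsets $D_j\subseteq C_j$ with $|D_j|\le 1$ ($j\in[m]$) whose multiset union (the multiplicity of $i$ being $|\{j: i\in D_j\}|$) contains the request. $N(n,k,m;r)$ denotes the smallest $N$ for which an $(n,N,k,m;r)$-MCBC exists. When $r=1$ the code is called an $(n,N,k,m)$ combinatorial batch code (CBC) and the minimum is written $N(n,k,m)=N(n,k,m;1)$. -}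

module Defs where

open import Data.Nat using (ℕ; zero; suc; _+_; _*_; _∸_; _≤_; _/_; NonZero)
open import Data.Nat.Combinatorics using (_C_)
open import Data.Fin using (Fin)
open import Data.Fin.Properties using (_≟_)
open import Data.Fin.Subset using (Subset; _∈_; ∣_∣)
open import Data.Maybe using (Maybe; just; nothing)
open import Data.List using (List; map; allFin)
open import Data.Nat.ListAction using (sum)
open import Data.Product using (Σ; _×_; ∃)
open import Data.Bool using (if_then_else_)
open import Relation.Nullary using (does)
open import Relation.Binary.PropositionalEquality using (_≡_)
open import Data.Integer as ℤ using (ℤ; +_)
open import Data.Rational as ℚ using (ℚ; 0ℚ)

Σ[_] : ∀ {n} → (Fin n → ℕ) → ℕ
Σ[_] {n} f = sum (map f (allFin n))

-- A code: m servers C_1..C_m, each a subset of [n] (elements = Fin n).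
Code : ℕ → ℕ → Set
Code n m = Fin m → Subset n

size : ∀ {n m} → Code n m → ℕ
size 𝒞 = Σ[ (λ j → ∣ 𝒞 j ∣) ]

-- A multiset request of k elements of [n], every multiplicity ≤ r,
-- given by its multiplicity function μ.
Request : (n : ℕ) → ℕ → ℕ → (Fin n → ℕ) → Set
Request n k r μ = (Σ[ μ ] ≡ k) × (∀ i → μ i ≤ r)

-- Multiplicity of i in the multiset union of the D_j (D_j = nothing is ∅,
-- D_j = just x is {x}).
hits : ∀ {n} → Maybe (Fin n) → Fin n → ℕ
hits nothing  i = 0
hits (just x) i = if does (x ≟ i) then 1 else 0

count : ∀ {n m} → (Fin m → Maybe (Fin n)) → Fin n → ℕ
count D i = Σ[ (λ j → hits (D j) i) ]

-- The code can serve request μ: choose D_j ⊆ C_j with |D_j| ≤ 1 whose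
-- multiset union contains μ.
Serves : ∀ {n m} → Code n m → (Fin n → ℕ) → Set
Serves {n} {m} 𝒞 μ =
  Σ (Fin m → Maybe (Fin n)) λ D →
    (∀ j i → D j ≡ just i → i ∈ 𝒞 j) × (∀ i → μ i ≤ count D i)

IsMCBC : (n N k m r : ℕ) → Code n m → Set
IsMCBC n N k m r 𝒞 = (size 𝒞 ≡ N) × (∀ μ → Request n k r μ → Serves 𝒞 μ)

-- An (n,N,k,m;r)-MCBC exists.  (r = 1: an (n,N,k,m)-CBC exists.)
MCBC : (n N k m r : ℕ) → Set
MCBC n N k m r = Σ (Code n m) (IsMCBC n N k m r)

⌈_/_⌉ : (a b : ℕ) → .{{NonZero b}} → ℕ
⌈ a / b ⌉ = (a + b ∸ 1) / b

-- a / d as a rational; total (junk value 0 when d = 0, never used below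
-- since all denominators are positive under the hypotheses).
frac : ℕ → ℕ → ℚ
frac a zero    = 0ℚ
frac a (suc d) = (+ a) ℚ./ suc d

boundV : (n k m r c : ℕ) → .{{NonZero r}} → ℤ
boundV n k m r c =
  (+ (n * c)) ℤ.-
    ℚ.floor (frac (k ∸ c) (m ∸ k + 1) ℚ.*
             (frac (((k ∸ 1) / r) * (m C (k ∸ 1))) ((m ∸ c) C (k ∸ 1 ∸ c))
              ℚ.- frac n 1))

module Submission where

-- Everything is phrased through the degree  deg 𝒞 x = #{j | x ∈ C_j}:
-- the size of a code is Σ_x deg x, and a choice of singletons D_j ⊆ C_j
-- serves an element x at most deg x times.
-- (i)   Every x occurs with multiplicity r in some request (`between`, an
--       interpolation lemma for sums), hence deg x ≥ r and N ≥ rn.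
-- (ii)  A request with multiplicities ≤ i ≤ r is also one with bound r.
-- (iii) Identify [rn] with [r]×[n] (library `combine`/`remQuot`).  Copying
--       every element r times turns an MCBC into a CBC of r times the size
--       (a server choice is lifted copy by copy, `lift`); projecting a CBC on
--       [rn] to [n] gives an MCBC that is no larger, the t-th copy of x
--       standing for the t-th occurrence of x.
-- (iv)  A request with multiplicities ≤ r and k elements splits into r sets
--       of size ≤ ⌈k/r⌉ (`decompose`); the s-th set is served by the s-th of
--       r disjoint copies of a CBC with ⌊m/r⌋ servers.
-- (v)   Hall-type bound: any k−1 servers contain the whole server set of at
--       most ⌊(k−1)/r⌋ elements.  Double counting the pairs (x, W) with
--       C_x ⊆ W, |W| = k−1, together with a per-element binomial inequality,
--       gives an inequality of natural numbers that is finally rewritten as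
--       the rational bound `boundV`.

open import Defs
open import Data.Nat
  using (ℕ; zero; suc; _+_; _*_; _∸_; _/_; _%_; _≤_; _<_; _⊔_; NonZero; z≤n; s≤s; _≤?_; _<?_; >-nonZero⁻¹)
open import Data.Nat.Properties hiding (_≟_)
open import Data.Nat.Properties using () renaming (_≟_ to _≟ℕ_)
open import Data.Nat.DivMod using (m≡m%n+[m/n]*n; m%n<n; m/n*n≤m; m<n*o⇒m/o<n)
open import Data.Nat.Tactic.RingSolver using (solve-∀)
open import Data.Nat.Combinatorics using (_C_; nCk+nC[k+1]≡[n+1]C[k+1]; k>n⇒nCk≡0)
open import Data.Nat.ListAction using () renaming (sum to listSum)
open import Algebra.Properties.Semiring.Sum +-*-semiring
  using (sum-syntax; ∑-distrib-+; ∑-comm; sum-cong-≗; *-distribˡ-sum; sum-replicate-zero)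
  renaming (sum to ∑)
open import Data.Fin using (Fin; zero; suc; _↑ˡ_; _↑ʳ_; splitAt; combine; remQuot; toℕ)
open import Data.Fin.Properties
  using (_≟_; splitAt-↑ˡ; splitAt-↑ʳ; remQuot-combine; combine-remQuot; combine-injectiveˡ; combine-injectiveʳ)
open import Data.Fin.Subset as Sub using (Subset)
open import Data.Fin.Subset.Properties using (p⊆q⇒∣p∣≤∣q∣; ∣p∣≤n; ∣⊥∣≡0)
open import Data.Vec as V using (lookup)
open import Data.Vec.Properties using ([]=⇒lookup; lookup⇒[]=; lookup∘tabulate; lookup-replicate)
open import Data.Bool using (Bool; true; false; if_then_else_; _∧_)
open import Data.Maybe as Maybe using (Maybe; just; nothing)
open import Data.List as List using (List; []; _∷_; _++_)
open import Data.List.Properties using (map-tabulate)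
open import Data.List.Relation.Unary.All as All using (All)
import Data.List.Relation.Unary.All.Properties as All
open import Data.Product using (_×_; _,_; proj₁; proj₂; ∃)
open import Data.Sum using (_⊎_; inj₁; inj₂)
open import Data.Empty using (⊥-elim)
open import Function using (id; _∘_)
open import Relation.Nullary using (does; yes; no; ¬_)
open import Relation.Nullary.Decidable using (dec-true; dec-false)
open import Relation.Binary.PropositionalEquality
open import Data.Integer as ℤ using (+≤+)
import Data.Integer.Properties as ZP
open import Data.Integer.DivMod using (div-pos-is-/ℕ; n<s[n/ℕd]*d)
import Data.Integer.Tactic.RingSolver as ZR
open import Data.Rational as ℚ using (ℚ; mkℚ)
import Data.Rational.Properties as QP
open import Data.Rational.Unnormalised as U using (mkℚᵘ; *≤*)
import Data.Rational.Unnormalised.Properties as UP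

Σ≡∑ : ∀ {n} (f : Fin n → ℕ) → Σ[ f ] ≡ ∑ f
Σ≡∑ f = trans (cong listSum (map-tabulate id f)) (listSum-tabulate f)
  where
    listSum-tabulate : ∀ {n} (g : Fin n → ℕ) → listSum (List.tabulate g) ≡ ∑ g
    listSum-tabulate {zero} g = refl
    listSum-tabulate {suc n} g = cong (g zero +_) (listSum-tabulate (g ∘ suc))

∑-mono : ∀ {n} {f g : Fin n → ℕ} → (∀ i → f i ≤ g i) → ∑ f ≤ ∑ g
∑-mono {zero} f≤g = z≤n
∑-mono {suc n} f≤g = +-mono-≤ (f≤g zero) (∑-mono (f≤g ∘ suc))

∑-const : ∀ n c → ∑[ i < n ] c ≡ n * c
∑-const zero c = refl
∑-const (suc n) c = cong (c +_) (∑-const n c)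

∑-term : ∀ {n} (f : Fin n → ℕ) (x : Fin n) → f x ≤ ∑ f
∑-term f zero = m≤m+n _ _
∑-term f (suc x) = ≤-trans (∑-term (f ∘ suc) x) (m≤n+m _ _)

∑-<-witness : ∀ {n} (f g : Fin n → ℕ) → ∑ f < ∑ g → ∃ λ i → f i < g i
∑-<-witness {suc n} f g lt with f zero <? g zero
... | yes p = zero , p
... | no p with ∑-<-witness (f ∘ suc) (g ∘ suc)
                  (+-cancelˡ-< _ _ _ (≤-<-trans (+-monoˡ-≤ _ (≮⇒≥ p)) lt))
...   | i , q = suc i , q

∑-positive : ∀ {n} (f : Fin n → ℕ) → 0 < ∑ f → ∃ λ i → 0 < f i
∑-positive {n} f pos = ∑-<-witness (λ _ → 0) f (subst (_< ∑ f) (sym (sum-replicate-zero n)) pos)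

∑-∸ : ∀ {n} (f g : Fin n → ℕ) → (∀ i → g i ≤ f i) → ∑ (λ i → f i ∸ g i) + ∑ g ≡ ∑ f
∑-∸ f g g≤f = trans (sym (∑-distrib-+ (λ i → f i ∸ g i) g)) (sum-cong-≗ (λ i → m∸n+n≡m (g≤f i)))

∑-↑ : ∀ a {b} (f : Fin (a + b) → ℕ) → ∑ f ≡ ∑ (λ i → f (i ↑ˡ b)) + ∑ (λ j → f (a ↑ʳ j))
∑-↑ zero f = refl
∑-↑ (suc a) f = trans (cong (f zero +_) (∑-↑ a (f ∘ suc))) (sym (+-assoc (f zero) _ _))

∑-combine : ∀ r {n} (f : Fin (r * n) → ℕ) → ∑ f ≡ ∑[ t < r ] ∑[ x < n ] f (combine t x)
∑-combine zero f = refl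
∑-combine (suc r) {n} f = trans (∑-↑ n f) (cong (∑ (λ i → f (i ↑ˡ (r * n))) +_) (∑-combine r (f ∘ (n ↑ʳ_))))

ind : Bool → ℕ
ind b = if b then 1 else 0

ind≤1 : ∀ b → ind b ≤ 1
ind≤1 true = s≤s z≤n
ind≤1 false = z≤n

δ : ∀ {n} → Fin n → Fin n → ℕ
δ x i = ind (does (x ≟ i))

δ-refl : ∀ {n} (x : Fin n) → δ x x ≡ 1
δ-refl x with x ≟ x
... | yes _ = refl
... | no x≢x = ⊥-elim (x≢x refl)

δ-≢ : ∀ {n} {x y : Fin n} → ¬ x ≡ y → δ x y ≡ 0
δ-≢ {x = x} {y} x≢y with x ≟ y
... | yes x≡y = ⊥-elim (x≢y x≡y)
... | no _ = refl

∑-pick : ∀ {n} (x : Fin n) (f : Fin n → ℕ) → ∑ (λ i → δ x i * f i) ≡ f x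
∑-pick {suc n} zero f =
  trans (cong₂ _+_ (*-identityˡ (f zero)) (sum-replicate-zero n)) (+-identityʳ _)
∑-pick {suc n} (suc x) f = ∑-pick x (f ∘ suc)

∑-δ : ∀ {n} (x : Fin n) → ∑ (δ x) ≡ 1
∑-δ x = trans (sum-cong-≗ (λ i → sym (*-identityʳ (δ x i)))) (∑-pick x (λ _ → 1))

mem : ∀ {n} → Subset n → Fin n → ℕ
mem p x = ind (lookup p x)

deg : ∀ {n m} → Code n m → Fin n → ℕ
deg 𝒞 x = ∑ (λ j → mem (𝒞 j) x)

∣∣≡∑mem : ∀ {n} (p : Subset n) → Sub.∣ p ∣ ≡ ∑ (mem p)
∣∣≡∑mem V.[] = refl
∣∣≡∑mem (true V.∷ p) = cong suc (∣∣≡∑mem p)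
∣∣≡∑mem (false V.∷ p) = ∣∣≡∑mem p

∈⇒mem≡1 : ∀ {n} (p : Subset n) x → x Sub.∈ p → mem p x ≡ 1
∈⇒mem≡1 p x x∈p rewrite []=⇒lookup x∈p = refl

size≡∑∑mem : ∀ {n m} (𝒞 : Code n m) → size 𝒞 ≡ ∑[ j < m ] ∑ (mem (𝒞 j))
size≡∑∑mem 𝒞 = trans (Σ≡∑ (λ j → Sub.∣ 𝒞 j ∣)) (sum-cong-≗ (λ j → ∣∣≡∑mem (𝒞 j)))

size≡∑deg : ∀ {n m} (𝒞 : Code n m) → size 𝒞 ≡ ∑ (deg 𝒞)
size≡∑deg 𝒞 = trans (size≡∑∑mem 𝒞) (∑-comm (λ j x → mem (𝒞 j) x))

count≡∑hits : ∀ {n m} (D : Fin m → Maybe (Fin n)) i → count D i ≡ ∑ (λ j → hits (D j) i)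
count≡∑hits D i = Σ≡∑ (λ j → hits (D j) i)

Fits : ∀ {n m} → Code n m → (Fin m → Maybe (Fin n)) → Set
Fits 𝒞 D = ∀ j i → D j ≡ just i → i Sub.∈ 𝒞 j

count≤deg : ∀ {n m} (𝒞 : Code n m) (D : Fin m → Maybe (Fin n)) → Fits 𝒞 D →
  ∀ x → count D x ≤ deg 𝒞 x
count≤deg 𝒞 D fits x = subst (_≤ deg 𝒞 x) (sym (count≡∑hits D x)) (∑-mono (λ j → hits≤mem (D j) (fits j) x))
  where
    hits≤mem : ∀ {p} d → (∀ i → d ≡ just i → i Sub.∈ p) → ∀ x → hits d x ≤ mem p x
    hits≤mem nothing _ x = z≤n
    hits≤mem {p} (just y) y∈p x with y ≟ x
    ... | yes refl = ≤-reflexive (sym (∈⇒mem≡1 p y (y∈p y refl)))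
    ... | no _ = z≤n

-- Interpolation: between two functions ℓ ≤ u every intermediate total k is
-- attained.  This is how requests with prescribed multiplicities are built.

between : ∀ {n} (ℓ u : Fin n → ℕ) k → (∀ i → ℓ i ≤ u i) → ∑ ℓ ≤ k → k ≤ ∑ u →
  ∃ λ μ → (∀ i → ℓ i ≤ μ i) × (∀ i → μ i ≤ u i) × (∑ μ ≡ k)
between ℓ u k ℓ≤u ∑ℓ≤k k≤∑u with raise (k ∸ ∑ ℓ) ℓ ℓ≤u (subst (_≤ ∑ u) (sym (m+[n∸m]≡n ∑ℓ≤k)) k≤∑u)
  where
    bump : ∀ ℓ → (∀ i → ℓ i ≤ u i) → ∑ ℓ < ∑ u →
      ∃ λ ℓ′ → (∀ i → ℓ i ≤ ℓ′ i) × (∀ i → ℓ′ i ≤ u i) × (∑ ℓ′ ≡ suc (∑ ℓ))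
    bump ℓ ℓ≤u lt with ∑-<-witness ℓ u lt
    ... | x , ℓx<ux = (λ i → ℓ i + δ x i) , (λ i → m≤m+n _ _) , bumped≤u ,
                      trans (∑-distrib-+ ℓ (δ x)) (trans (cong (∑ ℓ +_) (∑-δ x)) (+-comm (∑ ℓ) 1))
      where
        bumped≤u : ∀ i → ℓ i + δ x i ≤ u i
        bumped≤u i with x ≟ i
        ... | yes refl = subst (_≤ u x) (+-comm 1 (ℓ x)) ℓx<ux
        ... | no _ = subst (_≤ u i) (sym (+-identityʳ (ℓ i))) (ℓ≤u i)
    raise : ∀ d ℓ → (∀ i → ℓ i ≤ u i) → ∑ ℓ + d ≤ ∑ u →
      ∃ λ μ → (∀ i → ℓ i ≤ μ i) × (∀ i → μ i ≤ u i) × (∑ μ ≡ ∑ ℓ + d)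
    raise zero ℓ ℓ≤u _ = ℓ , (λ i → ≤-refl) , ℓ≤u , sym (+-identityʳ _)
    raise (suc d) ℓ ℓ≤u h with bump ℓ ℓ≤u (<-≤-trans (m<m+n (∑ ℓ) (s≤s z≤n)) h)
    ... | ℓ′ , ℓ≤ℓ′ , ℓ′≤u , ∑ℓ′ with raise d ℓ′ ℓ′≤u (subst (λ s → s + d ≤ ∑ u) (sym ∑ℓ′) (subst (_≤ ∑ u) (+-suc (∑ ℓ) d) h))
    ...   | μ , ℓ′≤μ , μ≤u , ∑μ = μ , (λ i → ≤-trans (ℓ≤ℓ′ i) (ℓ′≤μ i)) , μ≤u ,
                                  trans ∑μ (trans (cong (_+ d) ∑ℓ′) (sym (+-suc (∑ ℓ) d)))
... | μ , ℓ≤μ , μ≤u , ∑μ = μ , ℓ≤μ , μ≤u , trans ∑μ (m+[n∸m]≡n ∑ℓ≤k)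

served≤deg : ∀ {n m} (𝒞 : Code n m) {μ} → Serves 𝒞 μ → ∀ x → μ x ≤ deg 𝒞 x
served≤deg 𝒞 (D , fits , covers) x = ≤-trans (covers x) (count≤deg 𝒞 D fits x)

-- Part (i).  When r ≤ k ≤ rn, every element has multiplicity r in some
-- request, so every element of an MCBC has degree ≥ r.

request-through : ∀ n k r → r ≤ k → k ≤ r * n → (x : Fin n) →
  ∃ λ μ → Request n k r μ × r ≤ μ x
request-through n k r r≤k k≤rn x with between (λ i → δ x i * r) (λ _ → r) k δr≤r ∑δr≤k k≤∑r
  where
    δr≤r : ∀ i → δ x i * r ≤ r
    δr≤r i = subst (δ x i * r ≤_) (*-identityˡ r) (*-monoˡ-≤ r (ind≤1 (does (x ≟ i))))
    ∑δr≤k : ∑ (λ i → δ x i * r) ≤ k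
    ∑δr≤k = subst (_≤ k) (sym (∑-pick x (λ _ → r))) r≤k
    k≤∑r : k ≤ ∑[ i < n ] r
    k≤∑r = subst (k ≤_) (sym (trans (∑-const n r) (*-comm n r))) k≤rn
... | μ , ℓ≤μ , μ≤r , ∑μ =
  μ , (trans (Σ≡∑ μ) ∑μ , μ≤r) , subst (_≤ μ x) (trans (cong (_* r) (δ-refl x)) (*-identityˡ r)) (ℓ≤μ x)

size≥rn : ∀ n k m r → r ≤ k → k ≤ r * n → ∀ N → MCBC n N k m r → r * n ≤ N
size≥rn n k m r r≤k k≤rn N (𝒞 , size≡N , serves) = begin
  r * n            ≡⟨ *-comm r n ⟩
  n * r            ≡⟨ ∑-const n r ⟨
  ∑[ x < n ] r     ≤⟨ ∑-mono deg≥r ⟩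
  ∑ (deg 𝒞)        ≡⟨ trans (sym (size≡∑deg 𝒞)) size≡N ⟩
  N                ∎
  where
    open ≤-Reasoning
    deg≥r : ∀ x → r ≤ deg 𝒞 x
    deg≥r x with request-through n k r r≤k k≤rn x
    ... | μ , req , r≤μx = ≤-trans r≤μx (served≤deg 𝒞 (serves μ req) x)

-- Part (ii).  Lowering the multiplicity bound only removes requests.
lower-multiplicity : ∀ {n N k m r i} → i ≤ r → MCBC n N k m r → MCBC n N k m i
lower-multiplicity i≤r (𝒞 , size≡N , serves) =
  𝒞 , size≡N , λ μ (∑μ , μ≤i) → serves μ (∑μ , λ x → ≤-trans (μ≤i x) i≤r)

-- The elements of [r·n] as r copies of [n]: `combine t x` is the t-th copy
-- of x, and `origin r y` is the element of which y is a copy.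

origin : ∀ r {n} → Fin (r * n) → Fin n
origin r {n} y = proj₂ (remQuot {r} n y)

copyIndex : ∀ r {n} → Fin (r * n) → Fin r
copyIndex r {n} y = proj₁ (remQuot {r} n y)

origin-combine : ∀ {r n} (t : Fin r) (x : Fin n) → origin r (combine t x) ≡ x
origin-combine t x = cong proj₂ (remQuot-combine t x)

combine-origin : ∀ r {n} (y : Fin (r * n)) → combine (copyIndex r y) (origin r y) ≡ y
combine-origin r {n} y = combine-remQuot {r} n y

δ-combine : ∀ {r n} (t₀ t : Fin r) (x₀ x : Fin n) → δ (combine t₀ x₀) (combine t x) ≡ δ t₀ t * δ x₀ x
δ-combine t₀ t x₀ x with t₀ ≟ t | x₀ ≟ x
... | yes refl | yes refl = δ-refl (combine t₀ x₀)
... | yes refl | no x₀≢x = δ-≢ (x₀≢x ∘ combine-injectiveʳ t₀ x₀ t₀ x)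
... | no t₀≢t | _ = δ-≢ (t₀≢t ∘ combine-injectiveˡ t₀ x₀ t x)

∑-δ-copies : ∀ r {n} (y : Fin (r * n)) (x : Fin n) → ∑[ t < r ] δ y (combine t x) ≡ δ (origin r y) x
∑-δ-copies r y x = begin
  ∑[ t < r ] δ y (combine t x)          ≡⟨ sum-cong-≗ {r} (λ t → cong (λ z → δ z (combine t x)) (sym (combine-origin r y))) ⟩
  ∑[ t < r ] δ (combine t₀ x₀) (combine t x) ≡⟨ sum-cong-≗ {r} (λ t → trans (δ-combine t₀ t x₀ x) (*-comm (δ t₀ t) (δ x₀ x))) ⟩
  ∑[ t < r ] (δ x₀ x * δ t₀ t) ≡⟨ *-distribˡ-sum (δ x₀ x) (δ t₀) ⟨
  δ x₀ x * ∑ (δ t₀)                      ≡⟨ cong (δ x₀ x *_) (∑-δ t₀) ⟩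
  δ x₀ x * 1                             ≡⟨ *-identityʳ (δ x₀ x) ⟩
  δ x₀ x                                 ∎
  where
    open ≡-Reasoning
    t₀ = copyIndex r y
    x₀ = origin r y

∑-uncurry : ∀ r {n} (h : Fin r → Fin n → ℕ) → ∑ (λ y → h (copyIndex r y) (origin r y)) ≡ ∑[ t < r ] ∑ (h t)
∑-uncurry r h = trans (∑-combine r _)
  (sum-cong-≗ {r} (λ t → sum-cong-≗ (λ x → cong (λ p → h (proj₁ p) (proj₂ p)) (remQuot-combine t x))))

∑-origin : ∀ r {n} (g : Fin n → ℕ) → ∑ (g ∘ origin r) ≡ r * ∑ g
∑-origin r g = trans (∑-uncurry r (λ _ → g)) (∑-const r (∑ g))

-- If D serves, for every x, the
-- total demand `copies ν x` of the copies of x, then some choice D′ of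
-- copies of the elements chosen by D serves ν itself: each time D serves x,
-- D′ serves one copy of x that still has demand.

module Lifting (r : ℕ) {n : ℕ} where

  copies : (Fin (r * n) → ℕ) → Fin n → ℕ
  copies ν x = ∑[ t < r ] ν (combine t x)

  LiftOf : ∀ {m} → (Fin m → Maybe (Fin n)) → (Fin (r * n) → ℕ) → Set
  LiftOf {m} D ν = ∃ λ (D′ : Fin m → Maybe (Fin (r * n))) →
    (∀ j y → D′ j ≡ just y → D j ≡ just (origin r y)) × (∀ y → ν y ≤ ∑ (λ j → hits (D′ j) y))

  prepend-idle : ∀ {m} {D : Fin (suc m) → Maybe (Fin n)} {ν} → LiftOf (D ∘ suc) ν → LiftOf D ν
  prepend-idle (D′ , picks , covers) =
    (λ { zero → nothing ; (suc j) → D′ j }) , (λ { zero y () ; (suc j) → picks j }) , covers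

  prepend-copy : ∀ {m} {D : Fin (suc m) → Maybe (Fin n)} {ν} y₀ → D zero ≡ just (origin r y₀) →
    LiftOf (D ∘ suc) (λ y → ν y ∸ δ y₀ y) → LiftOf D ν
  prepend-copy {ν = ν} y₀ D₀≡ (D′ , picks , covers) =
    (λ { zero → just y₀ ; (suc j) → D′ j }) , (λ { zero y refl → D₀≡ ; (suc j) → picks j }) ,
    λ y → ≤-trans (m≤n+m∸n (ν y) (δ y₀ y)) (+-monoʳ-≤ (δ y₀ y) (covers y))

  lift : ∀ {m} (D : Fin m → Maybe (Fin n)) ν →
    (∀ x → copies ν x ≤ ∑ (λ j → hits (D j) x)) → LiftOf D ν
  lift {zero} D ν demand = (λ ()) , (λ ()) , ν≤0
    where
      ν≤0 : ∀ y → ν y ≤ 0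
      ν≤0 y = ≤-trans (subst (λ z → ν z ≤ copies ν (origin r y)) (combine-origin r y)
                        (∑-term (λ t → ν (combine t (origin r y))) (copyIndex r y)))
                      (demand (origin r y))
  lift {suc m} D ν demand with D zero in D₀≡
  ... | nothing = prepend-idle (lift (D ∘ suc) ν demand)
  ... | just x₀ with copies ν x₀ ≟ℕ 0
  ...   | yes none = prepend-idle (lift (D ∘ suc) ν demand′)
    where
      demand′ : ∀ x → copies ν x ≤ ∑ (λ j → hits (D (suc j)) x)
      demand′ x with x₀ ≟ x
      ... | yes refl = subst (_≤ _) (sym none) z≤n
      ... | no x₀≢x = subst (λ d → copies ν x ≤ d + _) (δ-≢ x₀≢x) (demand x)
  ...   | no some with ∑-positive (λ t → ν (combine t x₀)) (n≢0⇒n>0 some)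
  ...     | t₀ , pos = prepend-copy y₀ (trans D₀≡ (cong just (sym (origin-combine {r} t₀ x₀))))
                         (lift (D ∘ suc) (λ y → ν y ∸ δ y₀ y) demand′)
    where
      y₀ : Fin (r * n)
      y₀ = combine t₀ x₀
      δ≤ν : ∀ y → δ y₀ y ≤ ν y
      δ≤ν y with y₀ ≟ y
      ... | yes refl = pos
      ... | no _ = z≤n
      demand′ : ∀ x → copies (λ y → ν y ∸ δ y₀ y) x ≤ ∑ (λ j → hits (D (suc j)) x)
      demand′ x = +-cancelʳ-≤ (δ x₀ x) _ _ (begin
        copies (λ y → ν y ∸ δ y₀ y) x + δ x₀ x
          ≡⟨ cong (copies (λ y → ν y ∸ δ y₀ y) x +_) (sym (trans (∑-δ-copies r y₀ x) (cong (λ z → δ z x) (origin-combine {r} t₀ x₀)))) ⟩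
        copies (λ y → ν y ∸ δ y₀ y) x + copies (δ y₀) x
          ≡⟨ ∑-∸ {r} (λ t → ν (combine t x)) (λ t → δ y₀ (combine t x)) (λ t → δ≤ν (combine t x)) ⟩
        copies ν x
          ≤⟨ demand x ⟩
        δ x₀ x + ∑ (λ j → hits (D (suc j)) x)
          ≡⟨ +-comm (δ x₀ x) _ ⟩
        ∑ (λ j → hits (D (suc j)) x) + δ x₀ x ∎)
        where open ≤-Reasoning

open Lifting using (copies; lift)

blowUp : ∀ r {n m} → Code n m → Code (r * n) m
blowUp r 𝒞 j = V.tabulate (λ y → lookup (𝒞 j) (origin r y))

mem-blowUp : ∀ r {n m} (𝒞 : Code n m) j y → mem (blowUp r 𝒞 j) y ≡ mem (𝒞 j) (origin r y)
mem-blowUp r 𝒞 j y = cong ind (lookup∘tabulate (λ y → lookup (𝒞 j) (origin r y)) y)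

size-blowUp : ∀ r {n m} (𝒞 : Code n m) → size (blowUp r 𝒞) ≡ r * size 𝒞
size-blowUp r {m = m} 𝒞 = begin
  size (blowUp r 𝒞)                            ≡⟨ size≡∑∑mem (blowUp r 𝒞) ⟩
  ∑[ j < m ] ∑ (mem (blowUp r 𝒞 j))             ≡⟨ sum-cong-≗ (λ j → sum-cong-≗ (mem-blowUp r 𝒞 j)) ⟩
  ∑[ j < m ] ∑ (mem (𝒞 j) ∘ origin r)           ≡⟨ sum-cong-≗ (λ j → ∑-origin r (mem (𝒞 j))) ⟩
  ∑[ j < m ] (r * ∑ (mem (𝒞 j)))                ≡⟨ *-distribˡ-sum r (λ j → ∑ (mem (𝒞 j))) ⟨
  r * ∑[ j < m ] ∑ (mem (𝒞 j))                  ≡⟨ cong (r *_) (size≡∑∑mem 𝒞) ⟨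
  r * size 𝒞                                    ∎
  where open ≡-Reasoning

-- A CBC request μ′ on [rn] collapses to the MCBC request `copies μ′` on [n];
-- a choice serving the collapsed request lifts to one serving μ′.
blowUp-serves : ∀ {n k m r} (𝒞 : Code n m) → (∀ μ → Request n k r μ → Serves 𝒞 μ) →
  ∀ μ′ → Request (r * n) k 1 μ′ → Serves (blowUp r 𝒞) μ′
blowUp-serves {n} {k} {m} {r} 𝒞 serves μ′ (∑μ′ , μ′≤1)
  with serves (copies r μ′) (∑collapsed , collapsed≤r)
  where
    ∑collapsed : Σ[ copies r μ′ ] ≡ k
    ∑collapsed = begin
      Σ[ copies r μ′ ]                         ≡⟨ Σ≡∑ (copies r μ′) ⟩
      ∑[ x < n ] ∑[ t < r ] μ′ (combine t x)    ≡⟨ ∑-comm {n} {r} (λ x t → μ′ (combine t x)) ⟩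
      ∑[ t < r ] ∑[ x < n ] μ′ (combine t x)    ≡⟨ ∑-combine r μ′ ⟨
      ∑ μ′                                     ≡⟨ trans (sym (Σ≡∑ μ′)) ∑μ′ ⟩
      k                                        ∎
      where open ≡-Reasoning
    collapsed≤r : ∀ x → copies r μ′ x ≤ r
    collapsed≤r x = subst (copies r μ′ x ≤_) (trans (∑-const r 1) (*-identityʳ r)) (∑-mono {r} (λ t → μ′≤1 (combine t x)))
... | D , fits , covers with lift r D μ′ (λ x → subst (_ ≤_) (count≡∑hits D x) (covers x))
...   | D′ , picks , covers′ = D′ , fits′ , λ y → subst (μ′ y ≤_) (sym (count≡∑hits D′ y)) (covers′ y)
  where
    fits′ : Fits (blowUp r 𝒞) D′
    fits′ j y D′j≡y = lookup⇒[]= y (blowUp r 𝒞 j)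
      (trans (lookup∘tabulate (λ y → lookup (𝒞 j) (origin r y)) y) ([]=⇒lookup (fits j (origin r y) (picks j y D′j≡y))))

blowUp-MCBC : ∀ n k m r N → MCBC n N k m r → ∃ λ N′ → N′ ≤ r * N × MCBC (r * n) N′ k m 1
blowUp-MCBC n k m r N (𝒞 , size≡N , serves) =
  size (blowUp r 𝒞) , ≤-reflexive (trans (size-blowUp r 𝒞) (cong (r *_) size≡N)) ,
  blowUp r 𝒞 , refl , blowUp-serves 𝒞 serves

-- A server of the
-- projection stores x iff it stores some copy of x; a request with
-- multiplicities ≤ r is served through its "first copies" request on [rn].

positive? : ℕ → Bool
positive? zero = false
positive? (suc _) = true

ind-positive?≤ : ∀ a → ind (positive? a) ≤ a
ind-positive?≤ zero = z≤n
ind-positive?≤ (suc a) = s≤s z≤n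

positive?-≥1 : ∀ {a} → 1 ≤ a → positive? a ≡ true
positive?-≥1 {suc a} _ = refl

below : ℕ → ℕ → ℕ
below i zero = 0
below zero (suc a) = 1
below (suc i) (suc a) = below i a

below≤1 : ∀ i a → below i a ≤ 1
below≤1 i zero = z≤n
below≤1 zero (suc a) = ≤-refl
below≤1 (suc i) (suc a) = below≤1 i a

∑-below : ∀ r a → a ≤ r → ∑[ t < r ] below (toℕ t) a ≡ a
∑-below r zero _ = sum-replicate-zero r
∑-below (suc r) (suc a) (s≤s a≤r) = cong suc (∑-below r a a≤r)

module _ (r : ℕ) {n m : ℕ} (𝒞′ : Code (r * n) m) where

  storedCopies : Fin m → Fin n → ℕ
  storedCopies j x = ∑[ t < r ] mem (𝒞′ j) (combine t x)

  project : Code n m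
  project j = V.tabulate (λ x → positive? (storedCopies j x))

  mem-project : ∀ j x → mem (project j) x ≡ ind (positive? (storedCopies j x))
  mem-project j x = cong ind (lookup∘tabulate (λ x → positive? (storedCopies j x)) x)

  size-project : size project ≤ size 𝒞′
  size-project = begin
    size project                                 ≡⟨ size≡∑∑mem project ⟩
    ∑[ j < m ] ∑ (mem (project j))                 ≤⟨ ∑-mono (λ j → ∑-mono (λ x → subst (_≤ storedCopies j x)
                                                         (sym (mem-project j x)) (ind-positive?≤ (storedCopies j x)))) ⟩
    ∑[ j < m ] ∑[ x < n ] storedCopies j x         ≡⟨ sum-cong-≗ (λ j → trans (∑-comm {n} {r} _) (sym (∑-combine r (mem (𝒞′ j))))) ⟩
    ∑[ j < m ] ∑ (mem (𝒞′ j))                      ≡⟨ size≡∑∑mem 𝒞′ ⟨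
    size 𝒞′                                       ∎
    where open ≤-Reasoning

  firstCopies : (Fin n → ℕ) → Fin (r * n) → ℕ
  firstCopies μ y = below (toℕ (copyIndex r y)) (μ (origin r y))

  firstCopies-combine : ∀ μ t x → firstCopies μ (combine t x) ≡ below (toℕ t) (μ x)
  firstCopies-combine μ t x = cong (λ p → below (toℕ (proj₁ p)) (μ (proj₂ p))) (remQuot-combine t x)

  copies-firstCopies : ∀ μ → (∀ x → μ x ≤ r) → ∀ x → copies r (firstCopies μ) x ≡ μ x
  copies-firstCopies μ μ≤r x = trans (sum-cong-≗ {r} (λ t → firstCopies-combine μ t x)) (∑-below r (μ x) (μ≤r x))

  firstCopies-request : ∀ {k} μ → Request n k r μ → Request (r * n) k 1 (firstCopies μ)
  firstCopies-request {k} μ (∑μ , μ≤r) = ∑first , λ y → below≤1 (toℕ (copyIndex r y)) (μ (origin r y))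
    where
      ∑first : Σ[ firstCopies μ ] ≡ k
      ∑first = begin
        Σ[ firstCopies μ ]                                 ≡⟨ Σ≡∑ (firstCopies μ) ⟩
        ∑ (firstCopies μ)                                  ≡⟨ ∑-combine r (firstCopies μ) ⟩
        ∑[ t < r ] ∑[ x < n ] firstCopies μ (combine t x)   ≡⟨ ∑-comm {r} {n} (λ t x → firstCopies μ (combine t x)) ⟩
        ∑[ x < n ] copies r (firstCopies μ) x              ≡⟨ sum-cong-≗ (copies-firstCopies μ μ≤r) ⟩
        ∑ μ                                                ≡⟨ trans (sym (Σ≡∑ μ)) ∑μ ⟩
        k                                                  ∎
        where open ≡-Reasoning

  project-fits : ∀ D′ → Fits 𝒞′ D′ → Fits project (Maybe.map (origin r) ∘ D′)
  project-fits D′ fits j x D≡x with D′ j in D′j≡y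
  project-fits D′ fits j x refl | just y =
    lookup⇒[]= (origin r y) (project j) (trans (lookup∘tabulate (λ x → positive? (storedCopies j x)) (origin r y))
      (positive?-≥1 (≤-trans (≤-reflexive (sym y∈)) (∑-term (λ t → mem (𝒞′ j) (combine t (origin r y))) (copyIndex r y)))))
    where
      y∈ : mem (𝒞′ j) (combine (copyIndex r y) (origin r y)) ≡ 1
      y∈ = trans (cong (mem (𝒞′ j)) (combine-origin r y)) (∈⇒mem≡1 (𝒞′ j) y (fits j y D′j≡y))

  project-count : ∀ (D′ : Fin m → Maybe (Fin (r * n))) x →
    copies r (count D′) x ≤ count (Maybe.map (origin r) ∘ D′) x
  project-count D′ x = begin
    ∑[ t < r ] count D′ (combine t x)                          ≡⟨ sum-cong-≗ {r} (λ t → count≡∑hits D′ (combine t x)) ⟩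
    ∑[ t < r ] ∑[ j < m ] hits (D′ j) (combine t x)             ≡⟨ ∑-comm {r} {m} (λ t j → hits (D′ j) (combine t x)) ⟩
    ∑[ j < m ] ∑[ t < r ] hits (D′ j) (combine t x)             ≤⟨ ∑-mono (λ j → hits-copies (D′ j)) ⟩
    ∑[ j < m ] hits (Maybe.map (origin r) (D′ j)) x            ≡⟨ count≡∑hits (Maybe.map (origin r) ∘ D′) x ⟨
    count (Maybe.map (origin r) ∘ D′) x                        ∎
    where
      open ≤-Reasoning
      hits-copies : ∀ d → ∑[ t < r ] hits d (combine t x) ≤ hits (Maybe.map (origin r) d) x
      hits-copies nothing = ≤-reflexive (sum-replicate-zero r)
      hits-copies (just y) = ≤-reflexive (∑-δ-copies r y x)

  project-serves : ∀ {k} → (∀ μ′ → Request (r * n) k 1 μ′ → Serves 𝒞′ μ′) →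
    ∀ μ → Request n k r μ → Serves project μ
  project-serves serves μ req@(_ , μ≤r) with serves (firstCopies μ) (firstCopies-request μ req)
  ... | D′ , fits , covers = Maybe.map (origin r) ∘ D′ , project-fits D′ fits , covers′
    where
      covers′ : ∀ x → μ x ≤ count (Maybe.map (origin r) ∘ D′) x
      covers′ x = ≤-trans (≤-reflexive (sym (copies-firstCopies μ μ≤r x)))
                    (≤-trans (∑-mono {r} (λ t → covers (combine t x))) (project-count D′ x))

project-MCBC : ∀ n k m r N → MCBC (r * n) N k m 1 → ∃ λ N′ → N′ ≤ N × MCBC n N′ k m r
project-MCBC n k m r N (𝒞′ , size≡N , serves) =
  size (project r 𝒞′) , subst (_ ≤_) size≡N (size-project r 𝒞′) , project r 𝒞′ , refl , project-serves r 𝒞′ serves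

-- Decomposition: a multiplicity function μ with μ x ≤ t and
-- ∑ μ ≤ t·K is covered by t sets ν₁,…,ν_t of size ≤ K each.  The first set
-- must contain every x with μ x = t (so that the rest is bounded by t−1) and
-- enough elements that the rest sums to ≤ (t−1)·K; `between` provides it.

reached : ℕ → ℕ → ℕ
reached t a = ind (does (t ≤? a))

reached-yes : ∀ {t a} → t ≤ a → reached t a ≡ 1
reached-yes {t} {a} t≤a = cong ind (dec-true (t ≤? a) t≤a)

reached-no : ∀ {t a} → ¬ t ≤ a → reached t a ≡ 0
reached-no {t} {a} t≰a = cong ind (dec-false (t ≤? a) t≰a)

reached≤positive : ∀ t a → reached (suc t) a ≤ ind (positive? a)
reached≤positive t a with suc t ≤? a
... | yes 1+t≤a = ≤-reflexive (trans (reached-yes 1+t≤a) (sym (cong ind (positive?-≥1 (≤-trans (s≤s z≤n) 1+t≤a)))))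
... | no 1+t≰a = subst (_≤ _) (sym (reached-no 1+t≰a)) z≤n

reached-weight : ∀ t a → suc t * reached (suc t) a ≤ a
reached-weight t a with suc t ≤? a
... | yes 1+t≤a = subst (_≤ a) (sym (trans (cong (suc t *_) (reached-yes 1+t≤a)) (*-identityʳ (suc t)))) 1+t≤a
... | no 1+t≰a = subst (_≤ a) (sym (trans (cong (suc t *_) (reached-no 1+t≰a)) (*-zeroʳ (suc t)))) z≤n

rest-bound : ∀ t a v → a ≤ suc t → reached (suc t) a ≤ v → a ∸ v ≤ t
rest-bound t a v a≤1+t reached≤v with suc t ≤? a
... | yes 1+t≤a = ≤-trans (∸-monoʳ-≤ a (subst (_≤ v) (reached-yes 1+t≤a) reached≤v)) (m≤n+o⇒m∸n≤o a 1 a≤1+t)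
... | no 1+t≰a = ≤-trans (m∸n≤m a v) (≤-pred (≰⇒> 1+t≰a))

split-bound : ∀ t a → a ≤ suc t → a ≤ t * ind (positive? a) + reached (suc t) a
split-bound t zero _ = z≤n
split-bound t (suc a) 1+a≤1+t with suc t ≤? suc a
... | yes 1+t≤1+a =
  subst (suc a ≤_) (trans (+-comm 1 t) (cong₂ _+_ (sym (*-identityʳ t)) (sym (reached-yes 1+t≤1+a)))) 1+a≤1+t
... | no 1+t≰1+a =
  subst (suc a ≤_) (sym (trans (cong₂ _+_ (*-identityʳ t) (reached-no 1+t≰1+a)) (+-identityʳ t))) (≤-pred (≰⇒> 1+t≰1+a))

∑-reached≤ : ∀ t K {n} (μ : Fin n → ℕ) → ∑ μ ≤ suc t * K → ∑ (λ x → reached (suc t) (μ x)) ≤ K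
∑-reached≤ t K μ ∑μ≤ = *-cancelˡ-≤ (suc t) (≤-trans (≤-reflexive (*-distribˡ-sum (suc t) (λ x → reached (suc t) (μ x))))
  (≤-trans (∑-mono (λ x → reached-weight t (μ x))) ∑μ≤))

first-layer : ∀ t K {n} (μ : Fin n → ℕ) → (∀ x → μ x ≤ suc t) → ∑ μ ≤ suc t * K →
  ∃ λ ν → (∀ x → reached (suc t) (μ x) ≤ ν x) × (∀ x → ν x ≤ ind (positive? (μ x)))
        × (∑ ν ≤ K) × (∑ μ ≤ t * K + ∑ ν)
first-layer t K {n} μ μ≤ ∑μ≤ with between ℓ u target (λ x → reached≤positive t (μ x)) (m≤m⊔n (∑ ℓ) _) target≤∑u
  where
    ℓ u : Fin n → ℕ
    ℓ x = reached (suc t) (μ x)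
    u x = ind (positive? (μ x))
    target = ∑ ℓ ⊔ (∑ μ ∸ t * K)
    ∑μ≤t∑u+∑ℓ : ∑ μ ≤ t * ∑ u + ∑ ℓ
    ∑μ≤t∑u+∑ℓ = ≤-trans (∑-mono (λ x → split-bound t (μ x) (μ≤ x)))
                  (≤-reflexive (trans (∑-distrib-+ (λ x → t * u x) ℓ) (cong (_+ ∑ ℓ) (sym (*-distribˡ-sum t u)))))
    ∑μ≤tK+∑u : ∑ μ ≤ t * K + ∑ u
    ∑μ≤tK+∑u with ≤-total (∑ u) K
    ... | inj₁ ∑u≤K = ≤-trans ∑μ≤t∑u+∑ℓ (+-mono-≤ (*-monoʳ-≤ t ∑u≤K) (∑-mono (λ x → reached≤positive t (μ x))))
    ... | inj₂ K≤∑u = ≤-trans ∑μ≤ (subst (_≤ t * K + ∑ u) (+-comm (t * K) K) (+-monoʳ-≤ (t * K) K≤∑u))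
    target≤∑u : target ≤ ∑ u
    target≤∑u = ⊔-lub (∑-mono (λ x → reached≤positive t (μ x))) (m≤n+o⇒m∸n≤o (∑ μ) (t * K) ∑μ≤tK+∑u)
... | ν , ℓ≤ν , ν≤u , ∑ν = ν , ℓ≤ν , ν≤u , ∑ν≤K , ∑μ≤tK+∑ν
  where
    ∑ν≤K : ∑ ν ≤ K
    ∑ν≤K = subst (_≤ K) (sym ∑ν) (⊔-lub (∑-reached≤ t K μ ∑μ≤) (m≤n+o⇒m∸n≤o (∑ μ) (t * K) (subst (∑ μ ≤_) (+-comm K (t * K)) ∑μ≤)))
    ∑μ≤tK+∑ν : ∑ μ ≤ t * K + ∑ ν
    ∑μ≤tK+∑ν = subst (λ s → ∑ μ ≤ t * K + s) (sym ∑ν)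
                 (≤-trans (m≤n+m∸n (∑ μ) (t * K)) (+-monoʳ-≤ (t * K) (m≤n⊔m _ _)))

decompose : ∀ t K {n} (μ : Fin n → ℕ) → (∀ x → μ x ≤ t) → ∑ μ ≤ t * K →
  ∃ λ (ν : Fin t → Fin n → ℕ) → (∀ s x → ν s x ≤ 1) × (∀ s → ∑ (ν s) ≤ K) × (∀ x → μ x ≤ ∑[ s < t ] ν s x)
decompose zero K μ μ≤0 _ = (λ ()) , (λ ()) , (λ ()) , μ≤0
decompose (suc t) K {n} μ μ≤ ∑μ≤ with first-layer t K μ μ≤ ∑μ≤
... | ν₀ , reached≤ν₀ , ν₀≤positive , ∑ν₀≤K , ∑μ≤tK+∑ν₀
  with decompose t K (λ x → μ x ∸ ν₀ x) (λ x → rest-bound t (μ x) (ν₀ x) (μ≤ x) (reached≤ν₀ x)) ∑rest≤tK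
  where
    ν₀≤μ : ∀ x → ν₀ x ≤ μ x
    ν₀≤μ x = ≤-trans (ν₀≤positive x) (ind-positive?≤ (μ x))
    ∑rest≤tK : ∑ (λ x → μ x ∸ ν₀ x) ≤ t * K
    ∑rest≤tK = +-cancelʳ-≤ (∑ ν₀) _ _
      (subst (_≤ t * K + ∑ ν₀) (sym (∑-∸ μ ν₀ ν₀≤μ)) ∑μ≤tK+∑ν₀)
... | ν′ , ν′≤1 , ∑ν′≤K , rest≤ν′ = ν , ν≤1 , ∑ν≤K , μ≤∑ν
  where
    ν : Fin (suc t) → Fin n → ℕ
    ν zero = ν₀
    ν (suc s) = ν′ s
    ν≤1 : ∀ s x → ν s x ≤ 1
    ν≤1 zero x = ≤-trans (ν₀≤positive x) (ind≤1 _)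
    ν≤1 (suc s) = ν′≤1 s
    ∑ν≤K : ∀ s → ∑ (ν s) ≤ K
    ∑ν≤K zero = ∑ν₀≤K
    ∑ν≤K (suc s) = ∑ν′≤K s
    μ≤∑ν : ∀ x → μ x ≤ ∑[ s < suc t ] ν s x
    μ≤∑ν x = ≤-trans (m≤n+m∸n (μ x) (ν₀ x)) (+-monoʳ-≤ (ν₀ x) (rest≤ν′ x))

≤r*⌈/⌉ : ∀ k r .{{_ : NonZero r}} → k ≤ r * ⌈ k / r ⌉
≤r*⌈/⌉ k r = subst (k ≤_) (*-comm ⌈ k / r ⌉ r) (+-cancelʳ-≤ (r ∸ 1) k (⌈ k / r ⌉ * r) (begin
  k + (r ∸ 1)                        ≡⟨ +-∸-assoc k 1≤r ⟨
  a                                  ≡⟨ m≡m%n+[m/n]*n a r ⟩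
  a % r + ⌈ k / r ⌉ * r              ≤⟨ +-monoˡ-≤ (⌈ k / r ⌉ * r) (<⇒≤pred (m%n<n a r)) ⟩
  (r ∸ 1) + ⌈ k / r ⌉ * r            ≡⟨ +-comm (r ∸ 1) _ ⟩
  ⌈ k / r ⌉ * r + (r ∸ 1)            ∎))
  where
    open ≤-Reasoning
    a = k + r ∸ 1
    1≤r : 1 ≤ r
    1≤r = >-nonZero⁻¹ r

⌈/⌉≤ : ∀ k r n .{{_ : NonZero r}} → k ≤ r * n → ⌈ k / r ⌉ ≤ n
⌈/⌉≤ k r n k≤rn = ≤-pred (m<n*o⇒m/o<n (begin-strict
  k + r ∸ 1         ≡⟨ +-∸-assoc k (>-nonZero⁻¹ r) ⟩
  k + (r ∸ 1)       <⟨ +-monoʳ-< k (∸-monoʳ-< {r} {1} {0} (s≤s z≤n) (>-nonZero⁻¹ r)) ⟩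
  k + r             ≤⟨ +-monoˡ-≤ r (subst (k ≤_) (*-comm r n) k≤rn) ⟩
  n * r + r         ≡⟨ +-comm (n * r) r ⟩
  suc n * r         ∎))
  where open ≤-Reasoning

∑-splitAt : ∀ a {b} (g : Fin a ⊎ Fin b → ℕ) → ∑ (g ∘ splitAt a) ≡ ∑ (g ∘ inj₁) + ∑ (g ∘ inj₂)
∑-splitAt a {b} g = trans (∑-↑ a (g ∘ splitAt a))
  (cong₂ _+_ (sum-cong-≗ (λ i → cong g (splitAt-↑ˡ a i b))) (sum-cong-≗ (λ j → cong g (splitAt-↑ʳ a b j))))

Serves-mono : ∀ {n m} (𝒞 : Code n m) {μ μ′} → (∀ x → μ x ≤ μ′ x) → Serves 𝒞 μ′ → Serves 𝒞 μ
Serves-mono 𝒞 μ≤μ′ (D , fits , covers) = D , fits , λ x → ≤-trans (μ≤μ′ x) (covers x)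

pad-to-request : ∀ {n} K (ν : Fin n → ℕ) → (∀ x → ν x ≤ 1) → ∑ ν ≤ K → K ≤ n →
  ∃ λ ρ → (∀ x → ν x ≤ ρ x) × Request n K 1 ρ
pad-to-request {n} K ν ν≤1 ∑ν≤K K≤n with between ν (λ _ → 1) K ν≤1 ∑ν≤K (subst (K ≤_) (sym ∑1≡n) K≤n)
  where
    ∑1≡n : ∑[ x < n ] 1 ≡ n
    ∑1≡n = trans (∑-const n 1) (*-identityʳ n)
... | ρ , ν≤ρ , ρ≤1 , ∑ρ = ρ , ν≤ρ , trans (Σ≡∑ ρ) ∑ρ , ρ≤1

-- r disjoint copies of a code on m₀ servers followed by e idle servers; the
-- server `combine s j₀` of the first block is the s-th copy of server j₀.

module Replicate (r e : ℕ) {n m₀ : ℕ} (𝒞 : Code n m₀) where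

  block : Fin (r * m₀) ⊎ Fin e → Subset n
  block (inj₁ j′) = 𝒞 (origin r j′)
  block (inj₂ _) = Sub.⊥

  replicated : Code n (r * m₀ + e)
  replicated j = block (splitAt (r * m₀) j)

  size-replicated : size replicated ≡ r * size 𝒞
  size-replicated = begin
    size replicated                                          ≡⟨ size≡∑∑mem replicated ⟩
    ∑ (λ j → ∑ (mem (block (splitAt (r * m₀) j))))            ≡⟨ ∑-splitAt (r * m₀) (λ z → ∑ (mem (block z))) ⟩
    ∑ (λ j′ → ∑ (mem (𝒞 (origin r j′)))) + ∑[ i < e ] ∑ (mem (Sub.⊥ {n})) ≡⟨ cong₂ _+_ (∑-origin r (λ j₀ → ∑ (mem (𝒞 j₀))))
                                                                   (sum-cong-≗ {e} (λ _ → ∑-mem-⊥)) ⟩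
    r * ∑[ j₀ < m₀ ] ∑ (mem (𝒞 j₀)) + ∑[ i < e ] 0               ≡⟨ cong₂ _+_ (cong (r *_) (sym (size≡∑∑mem 𝒞))) (sum-replicate-zero e) ⟩
    r * size 𝒞 + 0                                          ≡⟨ +-identityʳ _ ⟩
    r * size 𝒞                                              ∎
    where
      open ≡-Reasoning
      ∑-mem-⊥ : ∑ (mem (Sub.⊥ {n})) ≡ 0
      ∑-mem-⊥ = trans (sum-cong-≗ {n} (λ x → cong ind (lookup-replicate x false))) (sum-replicate-zero n)

  pick : (Fin r → Fin m₀ → Maybe (Fin n)) → Fin (r * m₀) ⊎ Fin e → Maybe (Fin n)
  pick D (inj₁ j′) = D (copyIndex r j′) (origin r j′)
  pick D (inj₂ _) = nothing

  parallel : (Fin r → Fin m₀ → Maybe (Fin n)) → Fin (r * m₀ + e) → Maybe (Fin n)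
  parallel D j = pick D (splitAt (r * m₀) j)

  parallel-fits : ∀ D → (∀ s → Fits 𝒞 (D s)) → Fits replicated (parallel D)
  parallel-fits D fits j = pick-fits (splitAt (r * m₀) j)
    where
      pick-fits : ∀ z x → pick D z ≡ just x → x Sub.∈ block z
      pick-fits (inj₁ j′) = fits (copyIndex r j′) (origin r j′)
      pick-fits (inj₂ _) x ()

  count-parallel : ∀ D x → count (parallel D) x ≡ ∑[ s < r ] count (D s) x
  count-parallel D x = begin
    count (parallel D) x                                    ≡⟨ count≡∑hits (parallel D) x ⟩
    ∑ (λ j → hits (pick D (splitAt (r * m₀) j)) x)           ≡⟨ ∑-splitAt (r * m₀) (λ z → hits (pick D z) x) ⟩
    ∑ (λ j′ → hits (D (copyIndex r j′) (origin r j′)) x) + ∑[ i < e ] 0 ≡⟨ cong₂ _+_ (∑-uncurry r (λ s j₀ → hits (D s j₀) x))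
                                                                               (sum-replicate-zero e) ⟩
    ∑[ s < r ] ∑ (λ j₀ → hits (D s j₀) x) + 0               ≡⟨ +-identityʳ _ ⟩
    ∑[ s < r ] ∑ (λ j₀ → hits (D s j₀) x)                   ≡⟨ sum-cong-≗ (λ s → count≡∑hits (D s) x) ⟨
    ∑[ s < r ] count (D s) x                                ∎
    where open ≡-Reasoning

  replicated-serves : ∀ (ν : Fin r → Fin n → ℕ) → (∀ s → Serves 𝒞 (ν s)) →
    Serves replicated (λ x → ∑[ s < r ] ν s x)
  replicated-serves ν serves = parallel D , parallel-fits D (λ s → proj₁ (proj₂ (serves s))) , covers
    where
      D : Fin r → Fin m₀ → Maybe (Fin n)
      D s = proj₁ (serves s)
      covers : ∀ x → ∑[ s < r ] ν s x ≤ count (parallel D) x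
      covers x = subst (_ ≤_) (sym (count-parallel D x)) (∑-mono (λ s → proj₂ (proj₂ (serves s)) x))

-- N(n, k, m; r) ≤ r·N(n, ⌈k/r⌉, ⌊m/r⌋): r copies of a CBC with ⌊m/r⌋ servers
-- (padded by idle servers) serve every request via its decomposition.
replicate-MCBC : ∀ n k m r .{{_ : NonZero r}} → k ≤ r * n →
  ∀ N → MCBC n N ⌈ k / r ⌉ (m / r) 1 → ∃ λ N′ → N′ ≤ r * N × MCBC n N′ k m r
replicate-MCBC n k m r k≤rn N (𝒞 , size≡N , serves) =
  size replicated , ≤-reflexive (trans size-replicated (cong (r *_) size≡N)) ,
  subst (λ M → MCBC n (size replicated) k M r) r*m₀+e≡m (replicated , refl , serves′)
  where
    K = ⌈ k / r ⌉
    m₀ = m / r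
    e = m ∸ r * m₀
    open Replicate r e 𝒞
    r*m₀+e≡m : r * m₀ + e ≡ m
    r*m₀+e≡m = m+[n∸m]≡n (subst (_≤ m) (*-comm m₀ r) (m/n*n≤m m r))
    serves′ : ∀ μ → Request n k r μ → Serves replicated μ
    serves′ μ (∑μ , μ≤r) with decompose r K μ μ≤r (subst (_≤ r * K) (trans (sym ∑μ) (Σ≡∑ μ)) (≤r*⌈/⌉ k r))
    ... | ν , ν≤1 , ∑ν≤K , μ≤∑ν = Serves-mono replicated (λ x → ≤-trans (μ≤∑ν x) (∑-mono (λ s → ν≤ρ s x)))
                                   (replicated-serves ρ (λ s → serves (ρ s) (request s)))
      where
        padded : ∀ s → ∃ λ ρ → (∀ x → ν s x ≤ ρ x) × Request n K 1 ρ
        padded s = pad-to-request K (ν s) (ν≤1 s) (∑ν≤K s) (⌈/⌉≤ k r n k≤rn)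
        ρ : Fin r → Fin n → ℕ
        ρ s = proj₁ (padded s)
        ν≤ρ : ∀ s x → ν s x ≤ ρ s x
        ν≤ρ s = proj₁ (proj₂ (padded s))
        request : ∀ s → Request n K 1 (ρ s)
        request s = proj₂ (proj₂ (padded s))

binom : ℕ → ℕ → ℕ
binom zero zero = 1
binom zero (suc k) = 0
binom (suc n) zero = 1
binom (suc n) (suc k) = binom n k + binom n (suc k)

binom≡C : ∀ n k → binom n k ≡ n C k
binom≡C zero zero = refl
binom≡C zero (suc k) = sym (k>n⇒nCk≡0 {0} {suc k} (s≤s z≤n))
binom≡C (suc n) zero = refl
binom≡C (suc n) (suc k) = trans (cong₂ _+_ (binom≡C n k) (binom≡C n (suc k))) (nCk+nC[k+1]≡[n+1]C[k+1] n k)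

binom-0 : ∀ n → binom n 0 ≡ 1
binom-0 zero = refl
binom-0 (suc n) = refl

binom-column-0 : ∀ a b {c} → c ≡ 0 → binom a c ≡ binom b c
binom-column-0 a b refl = trans (binom-0 a) (sym (binom-0 b))

binom-pos : ∀ n k → k ≤ n → 1 ≤ binom n k
binom-pos zero zero _ = ≤-refl
binom-pos (suc n) zero _ = ≤-refl
binom-pos (suc n) (suc k) (s≤s k≤n) = ≤-trans (binom-pos n k k≤n) (m≤m+n _ _)

absorption : ∀ n k → suc k * binom (suc n) (suc k) ≡ suc n * binom n k
absorption zero zero = refl
absorption zero (suc k) = *-zeroʳ (suc (suc k))
absorption (suc n) zero = cong suc (begin
  1 * binom (suc n) 1    ≡⟨ absorption n zero ⟩
  suc n * binom n 0      ≡⟨ cong (suc n *_) (binom-0 n) ⟩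
  suc n * 1              ∎)
  where open ≡-Reasoning
absorption (suc n) (suc k) = begin
    suc (suc k) * (binom (suc n) (suc k) + binom (suc n) (suc (suc k)))
  ≡⟨ regroup (suc k) (binom (suc n) (suc k)) (binom (suc n) (suc (suc k))) ⟩
    suc k * binom (suc n) (suc k) + binom (suc n) (suc k) + suc (suc k) * binom (suc n) (suc (suc k))
  ≡⟨ cong₂ (λ a b → a + binom (suc n) (suc k) + b) (absorption n k) (absorption n (suc k)) ⟩
    suc n * binom n k + (binom n k + binom n (suc k)) + suc n * binom n (suc k)
  ≡⟨ collect (suc n) (binom n k) (binom n (suc k)) ⟩
    suc (suc n) * (binom n k + binom n (suc k))
  ∎
  where
    open ≡-Reasoning
    regroup : ∀ a x y → suc a * (x + y) ≡ a * x + x + suc a * y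
    regroup = solve-∀
    collect : ∀ a x y → a * x + (x + y) + a * y ≡ suc a * (x + y)
    collect = solve-∀

-- For a fixed width s, the sequence G s b = C(b+s, b) has increments
-- Δ s b = C(b+s, b+1) (G s (b+1) = G s b + Δ s b holds by definition), which
-- increase with b; thus G s is convex.

G : ℕ → ℕ → ℕ
G s b = binom (b + s) b

Δ : ℕ → ℕ → ℕ
Δ s b = binom (b + s) (suc b)

Δ-step : ∀ s b → Δ s b ≤ Δ s (suc b)
Δ-step s b = m≤m+n _ _

Δ-mono : ∀ s b e → Δ s b ≤ Δ s (b + e)
Δ-mono s b zero = ≤-reflexive (cong (Δ s) (sym (+-identityʳ b)))
Δ-mono s b (suc e) = ≤-trans (Δ-mono s b e) (≤-trans (Δ-step s (b + e)) (≤-reflexive (cong (Δ s) (sym (+-suc b e)))))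

G-absorption : ∀ s b → s * G s b ≡ suc b * Δ s b
G-absorption s b = +-cancelˡ-≡ (suc b * G s b) _ _ (begin
  suc b * G s b + s * G s b          ≡⟨ *-distribʳ-+ (G s b) (suc b) s ⟨
  suc (b + s) * G s b                ≡⟨ absorption (b + s) b ⟨
  suc b * binom (suc (b + s)) (suc b) ≡⟨ *-distribˡ-+ (suc b) (G s b) (Δ s b) ⟩
  suc b * G s b + suc b * Δ s b      ∎)
  where open ≡-Reasoning

G-above-tangent-right : ∀ s b₀ e → G s b₀ + e * Δ s b₀ ≤ G s (b₀ + e)
G-above-tangent-right s b₀ zero = ≤-reflexive (trans (+-identityʳ _) (cong (G s) (sym (+-identityʳ b₀))))
G-above-tangent-right s b₀ (suc e) = begin
  G s b₀ + (Δ s b₀ + e * Δ s b₀)     ≡⟨ swap (G s b₀) (Δ s b₀) (e * Δ s b₀) ⟩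
  (G s b₀ + e * Δ s b₀) + Δ s b₀     ≤⟨ +-mono-≤ (G-above-tangent-right s b₀ e) (Δ-mono s b₀ e) ⟩
  G s (b₀ + e) + Δ s (b₀ + e)        ≡⟨ cong (G s) (sym (+-suc b₀ e)) ⟩
  G s (b₀ + suc e)                   ∎
  where
    open ≤-Reasoning
    swap : ∀ a x y → a + (x + y) ≡ (a + y) + x
    swap = solve-∀

G-above-tangent-left : ∀ s b e → G s (b + e) ≤ G s b + e * Δ s (b + e)
G-above-tangent-left s b zero = ≤-reflexive (trans (cong (G s) (+-identityʳ b)) (sym (+-identityʳ _)))
G-above-tangent-left s b (suc e) = begin
  G s (b + suc e)                                  ≡⟨ cong (G s) (+-suc b e) ⟩
  G s (b + e) + Δ s (b + e)                        ≤⟨ +-monoˡ-≤ _ (G-above-tangent-left s b e) ⟩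
  G s b + e * Δ s (b + e) + Δ s (b + e)            ≤⟨ +-mono-≤ (+-monoʳ-≤ (G s b) (*-monoʳ-≤ e (Δ-step s (b + e))))
                                                              (Δ-step s (b + e)) ⟩
  G s b + e * Δ s (suc (b + e)) + Δ s (suc (b + e)) ≡⟨ collect (G s b) e (Δ s (suc (b + e))) ⟩
  G s b + suc e * Δ s (suc (b + e))                ≡⟨ cong (λ z → G s b + suc e * Δ s z) (sym (+-suc b e)) ⟩
  G s b + suc e * Δ s (b + suc e)                  ∎
  where
    open ≤-Reasoning
    collect : ∀ a e x → a + e * x + x ≡ a + suc e * x
    collect = solve-∀

-- An element of degree d lies in σ of the
-- (c+b₀)-subsets of servers, σ = G s (c + b₀ − d) when d ≤ c + b₀ (with
-- s = m − k + 1); convexity of G s around b₀ and s·G s b₀ = (b₀+1)·Δ s b₀ give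
--   (c·s + b₀ + 1)·G s b₀ ≤ d·s·G s b₀ + (b₀ + 1)·σ.

ElementBound : (c b₀ s d σ : ℕ) → Set
ElementBound c b₀ s d σ = (c * s + suc b₀) * G s b₀ ≤ d * s * G s b₀ + suc b₀ * σ

element-bound-low : ∀ d e b₀ s → ElementBound (d + e) b₀ s d (G s (b₀ + e))
element-bound-low d e b₀ s = begin
  ((d + e) * s + suc b₀) * B                     ≡⟨ expand d e s (suc b₀) B ⟩
  d * s * B + (e * (s * B) + suc b₀ * B)         ≡⟨ cong (λ z → d * s * B + (e * z + suc b₀ * B)) (G-absorption s b₀) ⟩
  d * s * B + (e * (suc b₀ * Δ s b₀) + suc b₀ * B) ≡⟨ factor (d * s * B) e (suc b₀) (Δ s b₀) B ⟩
  d * s * B + suc b₀ * (B + e * Δ s b₀)          ≤⟨ +-monoʳ-≤ (d * s * B) (*-monoʳ-≤ (suc b₀) (G-above-tangent-right s b₀ e)) ⟩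
  d * s * B + suc b₀ * G s (b₀ + e)              ∎
  where
    open ≤-Reasoning
    B = G s b₀
    expand : ∀ d e s x B → ((d + e) * s + x) * B ≡ d * s * B + (e * (s * B) + x * B)
    expand = solve-∀
    factor : ∀ a e x y B → a + (e * (x * y) + x * B) ≡ a + x * (B + e * y)
    factor = solve-∀

element-bound-high : ∀ c e b s → ElementBound c (b + e) s (c + e) (G s b)
element-bound-high c e b s = begin
  (c * s + x) * B                                 ≡⟨ *-distribʳ-+ B (c * s) x ⟩
  c * s * B + x * B                               ≤⟨ +-monoʳ-≤ (c * s * B) (*-monoʳ-≤ x (G-above-tangent-left s b e)) ⟩
  c * s * B + x * (G s b + e * Δ s (b + e))       ≡⟨ expand (c * s * B) x (G s b) e (Δ s (b + e)) ⟩
  c * s * B + (e * (x * Δ s (b + e)) + x * G s b) ≡⟨ cong (λ z → c * s * B + (e * z + x * G s b)) (G-absorption s (b + e)) ⟨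
  c * s * B + (e * (s * B) + x * G s b)           ≡⟨ collect c e s B (x * G s b) ⟩
  (c + e) * s * B + x * G s b                     ∎
  where
    open ≤-Reasoning
    x = suc (b + e)
    B = G s (b + e)
    expand : ∀ a x g e y → a + x * (g + e * y) ≡ a + (e * (x * y) + x * g)
    expand = solve-∀
    collect : ∀ c e s B y → c * s * B + (e * (s * B) + y) ≡ (c + e) * s * B + y
    collect = solve-∀

element-bound-large : ∀ c b₀ f s σ → 1 ≤ s → ElementBound c b₀ s (suc (c + b₀ + f)) σ
element-bound-large c b₀ f (suc s′) σ _ = ≤-trans (*-monoˡ-≤ (G s b₀) coefficient) (m≤m+n _ _)
  where
    s = suc s′
    expand : ∀ c b₀ f s → suc (c + b₀ + f) * s ≡ c * s + (suc b₀ * s + f * s)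
    expand = solve-∀
    coefficient : c * s + suc b₀ ≤ suc (c + b₀ + f) * s
    coefficient = subst (c * s + suc b₀ ≤_) (sym (expand c b₀ f s))
                    (+-monoʳ-≤ (c * s) (≤-trans (m≤m*n (suc b₀) s) (m≤m+n _ _)))

element-bound : ∀ c b₀ s d σ → 1 ≤ s → (d ≤ c + b₀ → σ ≡ G s (c + b₀ ∸ d)) → ElementBound c b₀ s d σ
element-bound c b₀ s d σ 1≤s σ≡ with d ≤? c + b₀
... | no d≰c+b₀ = subst (λ d → ElementBound c b₀ s d σ) (m+[n∸m]≡n (≰⇒> d≰c+b₀))
                    (element-bound-large c b₀ (d ∸ suc (c + b₀)) s σ 1≤s)
... | yes d≤c+b₀ with ≤-total b₀ b
  where b = c + b₀ ∸ d
...   | inj₁ b₀≤b = subst₂ (λ c′ σ′ → ElementBound c′ b₀ s d σ′) d+e≡c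
                      (sym (trans (σ≡ d≤c+b₀) (cong (G s) (sym (m+[n∸m]≡n b₀≤b)))))
                      (element-bound-low d (b ∸ b₀) b₀ s)
  where
    b = c + b₀ ∸ d
    d+e≡c : d + (b ∸ b₀) ≡ c
    d+e≡c = +-cancelʳ-≡ b₀ _ _ (trans (trans (+-assoc d (b ∸ b₀) b₀) (cong (d +_) (m∸n+n≡m b₀≤b))) (m+[n∸m]≡n d≤c+b₀))
...   | inj₂ b≤b₀ = subst₂ (λ b₀′ d′ → ElementBound c b₀′ s d′ σ) (m+[n∸m]≡n b≤b₀) (sym d≡c+e)
                      (subst (ElementBound c (b + (b₀ ∸ b)) s (c + (b₀ ∸ b))) (sym (σ≡ d≤c+b₀))
                        (element-bound-high c (b₀ ∸ b) b s))
  where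
    b = c + b₀ ∸ d
    d≡c+e : d ≡ c + (b₀ ∸ b)
    d≡c+e = +-cancelʳ-≡ b _ _ (trans (m+[n∸m]≡n d≤c+b₀)
              (trans (cong (c +_) (sym (m∸n+n≡m b≤b₀))) (sym (+-assoc c (b₀ ∸ b) b))))

_⊆ᵇ_ : ∀ {m} → Subset m → Subset m → Bool
V.[] ⊆ᵇ V.[] = true
(false V.∷ T) ⊆ᵇ (_ V.∷ W) = T ⊆ᵇ W
(true V.∷ T) ⊆ᵇ (c V.∷ W) = c ∧ (T ⊆ᵇ W)

⊆ᵇ-sound : ∀ {m} {T W : Subset m} → T ⊆ᵇ W ≡ true → T Sub.⊆ W
⊆ᵇ-sound {T = false V.∷ T} {_ V.∷ W} T⊆W (V.there x∈T) = V.there (⊆ᵇ-sound T⊆W x∈T)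
⊆ᵇ-sound {T = true V.∷ T} {true V.∷ W} _ V.here = V.here
⊆ᵇ-sound {T = true V.∷ T} {true V.∷ W} T⊆W (V.there x∈T) = V.there (⊆ᵇ-sound T⊆W x∈T)

⊥⊆ᵇ : ∀ {m} (W : Subset m) → Sub.⊥ ⊆ᵇ W ≡ true
⊥⊆ᵇ V.[] = refl
⊥⊆ᵇ (_ V.∷ W) = ⊥⊆ᵇ W

subsets : (m j : ℕ) → List (Subset m)
subsets zero zero = V.[] ∷ []
subsets zero (suc j) = []
subsets (suc m) zero = List.map (false V.∷_) (subsets m zero)
subsets (suc m) (suc j) = List.map (false V.∷_) (subsets m (suc j)) ++ List.map (true V.∷_) (subsets m j)

subsets-size : ∀ m j → All (λ W → Sub.∣ W ∣ ≡ j) (subsets m j)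
subsets-size zero zero = refl All.∷ All.[]
subsets-size zero (suc j) = All.[]
subsets-size (suc m) zero = All.map⁺ (subsets-size m zero)
subsets-size (suc m) (suc j) = All.++⁺ (All.map⁺ (subsets-size m (suc j))) (All.map⁺ (All.map (cong suc) (subsets-size m j)))

∑ₗ : ∀ {A : Set} → List A → (A → ℕ) → ℕ
∑ₗ [] g = 0
∑ₗ (a ∷ as) g = g a + ∑ₗ as g

∑ₗ-++ : ∀ {A : Set} (xs ys : List A) g → ∑ₗ (xs ++ ys) g ≡ ∑ₗ xs g + ∑ₗ ys g
∑ₗ-++ [] ys g = refl
∑ₗ-++ (x ∷ xs) ys g = trans (cong (g x +_) (∑ₗ-++ xs ys g)) (sym (+-assoc (g x) _ _))

∑ₗ-map : ∀ {A B : Set} (f : A → B) (xs : List A) g → ∑ₗ (List.map f xs) g ≡ ∑ₗ xs (g ∘ f)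
∑ₗ-map f [] g = refl
∑ₗ-map f (x ∷ xs) g = cong (g (f x) +_) (∑ₗ-map f xs g)

∑ₗ-cong : ∀ {A : Set} (xs : List A) {g h : A → ℕ} → (∀ a → g a ≡ h a) → ∑ₗ xs g ≡ ∑ₗ xs h
∑ₗ-cong [] _ = refl
∑ₗ-cong (x ∷ xs) g≡h = cong₂ _+_ (g≡h x) (∑ₗ-cong xs g≡h)

∑ₗ-mono : ∀ {A : Set} {xs : List A} {g h : A → ℕ} → All (λ a → g a ≤ h a) xs → ∑ₗ xs g ≤ ∑ₗ xs h
∑ₗ-mono All.[] = z≤n
∑ₗ-mono (g≤h All.∷ rest) = +-mono-≤ g≤h (∑ₗ-mono rest)

∑ₗ-const : ∀ {A : Set} (xs : List A) q → ∑ₗ xs (λ _ → q) ≡ q * ∑ₗ xs (λ _ → 1)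
∑ₗ-const [] q = sym (*-zeroʳ q)
∑ₗ-const (x ∷ xs) q = trans (cong₂ _+_ (sym (*-identityʳ q)) (∑ₗ-const xs q)) (sym (*-distribˡ-+ q 1 _))

∑ₗ-∑-comm : ∀ {A : Set} {n} (xs : List A) (g : A → Fin n → ℕ) → ∑ₗ xs (∑ ∘ g) ≡ ∑[ i < n ] ∑ₗ xs (λ a → g a i)
∑ₗ-∑-comm {n = n} [] g = sym (sum-replicate-zero n)
∑ₗ-∑-comm (x ∷ xs) g = trans (cong (∑ (g x) +_) (∑ₗ-∑-comm xs g)) (sym (∑-distrib-+ (g x) (λ i → ∑ₗ xs (λ a → g a i))))

∑ₗ-subsets-zero : ∀ m g → ∑ₗ (subsets (suc m) zero) g ≡ ∑ₗ (subsets m zero) (g ∘ (false V.∷_))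
∑ₗ-subsets-zero m g = ∑ₗ-map (false V.∷_) (subsets m zero) g

∑ₗ-subsets-suc : ∀ m j g →
  ∑ₗ (subsets (suc m) (suc j)) g ≡ ∑ₗ (subsets m (suc j)) (g ∘ (false V.∷_)) + ∑ₗ (subsets m j) (g ∘ (true V.∷_))
∑ₗ-subsets-suc m j g = trans (∑ₗ-++ (List.map (false V.∷_) (subsets m (suc j))) _ g)
  (cong₂ _+_ (∑ₗ-map (false V.∷_) (subsets m (suc j)) g) (∑ₗ-map (true V.∷_) (subsets m j) g))

supersets-empty : ∀ m j (T : Subset m) → j < Sub.∣ T ∣ → ∑ₗ (subsets m j) (λ W → ind (T ⊆ᵇ W)) ≡ 0
supersets-empty m j T j<∣T∣ = n≤0⇒n≡0 (≤-trans (∑ₗ-mono (All.map none (subsets-size m j))) (≤-reflexive (∑ₗ-const (subsets m j) 0)))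
  where
    none : ∀ {W} → Sub.∣ W ∣ ≡ j → ind (T ⊆ᵇ W) ≤ 0
    none {W} ∣W∣≡j with T ⊆ᵇ W in T⊆W
    ... | false = z≤n
    ... | true = ⊥-elim (<⇒≱ j<∣T∣ (subst (Sub.∣ T ∣ ≤_) ∣W∣≡j (p⊆q⇒∣p∣≤∣q∣ {p = T} {W} (⊆ᵇ-sound {T = T} {W} T⊆W))))

supersets : ∀ m j (T : Subset m) → Sub.∣ T ∣ ≤ j →
  ∑ₗ (subsets m j) (λ W → ind (T ⊆ᵇ W)) ≡ binom (m ∸ Sub.∣ T ∣) (j ∸ Sub.∣ T ∣)
supersets zero zero V.[] _ = refl
supersets zero (suc j) V.[] _ = refl
supersets (suc m) zero (false V.∷ T) ∣T∣≤0 =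
  trans (∑ₗ-subsets-zero m (λ W → ind ((false V.∷ T) ⊆ᵇ W)))
    (trans (supersets m zero T ∣T∣≤0) (binom-column-0 (m ∸ Sub.∣ T ∣) (suc m ∸ Sub.∣ T ∣) (0∸n≡0 Sub.∣ T ∣)))
supersets (suc m) (suc j) (true V.∷ T) (s≤s ∣T∣≤j) = begin
  ∑ₗ (subsets (suc m) (suc j)) (λ W → ind ((true V.∷ T) ⊆ᵇ W))
    ≡⟨ ∑ₗ-subsets-suc m j (λ W → ind ((true V.∷ T) ⊆ᵇ W)) ⟩
  ∑ₗ (subsets m (suc j)) (λ _ → 0) + ∑ₗ (subsets m j) (λ W → ind (T ⊆ᵇ W))
    ≡⟨ cong₂ _+_ (∑ₗ-const (subsets m (suc j)) 0) (supersets m j T ∣T∣≤j) ⟩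
  binom (m ∸ Sub.∣ T ∣) (j ∸ Sub.∣ T ∣) ∎
  where open ≡-Reasoning
supersets (suc m) (suc j) (false V.∷ T) ∣T∣≤1+j with Sub.∣ T ∣ ≤? j
... | yes ∣T∣≤j = begin
  ∑ₗ (subsets (suc m) (suc j)) (λ W → ind ((false V.∷ T) ⊆ᵇ W))
    ≡⟨ ∑ₗ-subsets-suc m j (λ W → ind ((false V.∷ T) ⊆ᵇ W)) ⟩
  ∑ₗ (subsets m (suc j)) (λ W → ind (T ⊆ᵇ W)) + ∑ₗ (subsets m j) (λ W → ind (T ⊆ᵇ W))
    ≡⟨ cong₂ _+_ (supersets m (suc j) T ∣T∣≤1+j) (supersets m j T ∣T∣≤j) ⟩
  binom (m ∸ t) (suc j ∸ t) + binom (m ∸ t) (j ∸ t)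
    ≡⟨ +-comm (binom (m ∸ t) (suc j ∸ t)) _ ⟩
  binom (m ∸ t) (j ∸ t) + binom (m ∸ t) (suc j ∸ t)
    ≡⟨ cong (λ z → binom (m ∸ t) (j ∸ t) + binom (m ∸ t) z) (+-∸-assoc 1 ∣T∣≤j) ⟩
  binom (suc (m ∸ t)) (suc (j ∸ t))
    ≡⟨ cong₂ binom (+-∸-assoc 1 (∣p∣≤n T)) (+-∸-assoc 1 ∣T∣≤j) ⟨
  binom (suc m ∸ t) (suc j ∸ t) ∎
  where
    open ≡-Reasoning
    t = Sub.∣ T ∣
... | no ∣T∣≰j = begin
  ∑ₗ (subsets (suc m) (suc j)) (λ W → ind ((false V.∷ T) ⊆ᵇ W))
    ≡⟨ ∑ₗ-subsets-suc m j (λ W → ind ((false V.∷ T) ⊆ᵇ W)) ⟩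
  ∑ₗ (subsets m (suc j)) (λ W → ind (T ⊆ᵇ W)) + ∑ₗ (subsets m j) (λ W → ind (T ⊆ᵇ W))
    ≡⟨ cong₂ _+_ (supersets m (suc j) T ∣T∣≤1+j) (supersets-empty m j T (≰⇒> ∣T∣≰j)) ⟩
  binom (m ∸ t) (suc j ∸ t) + 0
    ≡⟨ +-identityʳ _ ⟩
  binom (m ∸ t) (suc j ∸ t)
    ≡⟨ binom-column-0 (m ∸ t) (suc m ∸ t) (m≤n⇒m∸n≡0 (≰⇒> ∣T∣≰j)) ⟩
  binom (suc m ∸ t) (suc j ∸ t) ∎
  where
    open ≡-Reasoning
    t = Sub.∣ T ∣

count-subsets : ∀ m j → ∑ₗ (subsets m j) (λ _ → 1) ≡ binom m j
count-subsets m j = begin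
  ∑ₗ (subsets m j) (λ _ → 1)                        ≡⟨ ∑ₗ-cong (subsets m j) (λ W → cong ind (sym (⊥⊆ᵇ W))) ⟩
  ∑ₗ (subsets m j) (λ W → ind (Sub.⊥ ⊆ᵇ W))         ≡⟨ supersets m j Sub.⊥ (subst (_≤ j) (sym (∣⊥∣≡0 m)) z≤n) ⟩
  binom (m ∸ Sub.∣ Sub.⊥ {m} ∣) (j ∸ Sub.∣ Sub.⊥ {m} ∣) ≡⟨ cong (λ t → binom (m ∸ t) (j ∸ t)) (∣⊥∣≡0 m) ⟩
  binom m j                                          ∎
  where open ≡-Reasoning

-- An element is captured by a set W of servers when
-- all its servers lie in W.  Requests on captured elements can only be
-- served from W, so if W has j servers and requests of size j+1 with
-- multiplicities ≤ r are served, then W captures at most ⌊j/r⌋ elements.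

servers : ∀ {n m} → Code n m → Fin n → Subset m
servers 𝒞 x = V.tabulate (λ j → lookup (𝒞 j) x)

∣servers∣≡deg : ∀ {n m} (𝒞 : Code n m) x → Sub.∣ servers 𝒞 x ∣ ≡ deg 𝒞 x
∣servers∣≡deg 𝒞 x = trans (∣∣≡∑mem (servers 𝒞 x)) (sum-cong-≗ (λ j → cong ind (lookup∘tabulate (λ j → lookup (𝒞 j) x) j)))

captured : ∀ {n m} → Code n m → Subset m → Fin n → ℕ
captured 𝒞 W x = ind (servers 𝒞 x ⊆ᵇ W)

captured-load : ∀ {n m} (𝒞 : Code n m) (W : Subset m) D → Fits 𝒞 D →
  ∑ (λ x → captured 𝒞 W x * count D x) ≤ Sub.∣ W ∣
captured-load {n} {m} 𝒞 W D fits = begin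
  ∑ (λ x → captured 𝒞 W x * count D x)                   ≡⟨ sum-cong-≗ (λ x → trans (cong (captured 𝒞 W x *_) (count≡∑hits D x))
                                                                 (*-distribˡ-sum (captured 𝒞 W x) (λ j → hits (D j) x))) ⟩
  ∑[ x < n ] ∑[ j < m ] (captured 𝒞 W x * hits (D j) x)   ≡⟨ ∑-comm (λ x j → captured 𝒞 W x * hits (D j) x) ⟩
  ∑[ j < m ] ∑[ x < n ] (captured 𝒞 W x * hits (D j) x)   ≤⟨ ∑-mono (λ j → load (D j) (fits j)) ⟩
  ∑ (mem W)                                              ≡⟨ ∣∣≡∑mem W ⟨
  Sub.∣ W ∣                                              ∎
  where
    open ≤-Reasoning
    load : ∀ {j} d → (∀ y → d ≡ just y → y Sub.∈ 𝒞 j) → ∑[ x < n ] (captured 𝒞 W x * hits d x) ≤ mem W j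
    load {j} nothing _ = subst (_≤ mem W j) (sym (trans (sum-cong-≗ (λ x → *-zeroʳ (captured 𝒞 W x))) (sum-replicate-zero n))) z≤n
    load {j} (just y) y∈ = subst (_≤ mem W j)
      (sym (trans (sum-cong-≗ (λ x → *-comm (captured 𝒞 W x) (δ y x))) (∑-pick y (captured 𝒞 W)))) (in-W refl)
      where
        in-W : ∀ {b} → servers 𝒞 y ⊆ᵇ W ≡ b → ind b ≤ mem W j
        in-W {false} _ = z≤n
        in-W {true} y-captured = ≤-reflexive (cong ind (sym ([]=⇒lookup (⊆ᵇ-sound y-captured
          (lookup⇒[]= j (servers 𝒞 y) (trans (lookup∘tabulate (λ j → lookup (𝒞 j) y) j) ([]=⇒lookup (y∈ y refl))))))))

-- The Hall-type bound, by contradiction: otherwise j + 1 requests on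
-- captured elements (≤ r each) would need more than |W| = j servers.
hall : ∀ {n m} j r .{{_ : NonZero r}} (𝒞 : Code n m) → (∀ μ → Request n (suc j) r μ → Serves 𝒞 μ) →
  ∀ (W : Subset m) → Sub.∣ W ∣ ≡ j → ∑ (captured 𝒞 W) ≤ j / r
hall {n} j r 𝒞 serves W ∣W∣≡j with ∑ (captured 𝒞 W) ≤? j / r
... | yes bounded = bounded
... | no unbounded with between (λ _ → 0) (λ x → r * captured 𝒞 W x) (suc j) (λ _ → z≤n)
                          (subst (_≤ suc j) (sym (sum-replicate-zero n)) z≤n) (subst (suc j ≤_) (*-distribˡ-sum r (captured 𝒞 W)) j<r*captured)
  where
    j<r*captured : suc j ≤ r * ∑ (captured 𝒞 W)
    j<r*captured = begin
      suc j                          ≡⟨ cong suc (m≡m%n+[m/n]*n j r) ⟩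
      suc (j % r + j / r * r)        ≤⟨ +-monoˡ-≤ (j / r * r) (m%n<n j r) ⟩
      r + j / r * r                  ≡⟨⟩
      suc (j / r) * r                ≤⟨ *-monoˡ-≤ r (≰⇒> unbounded) ⟩
      ∑ (captured 𝒞 W) * r           ≡⟨ *-comm _ r ⟩
      r * ∑ (captured 𝒞 W)           ∎
      where open ≤-Reasoning
... | μ , _ , μ≤r*captured , ∑μ with serves μ (trans (Σ≡∑ μ) ∑μ , λ x → ≤-trans (μ≤r*captured x) (r*ind≤r x))
  where
    r*ind≤r : ∀ x → r * captured 𝒞 W x ≤ r
    r*ind≤r x = subst (r * captured 𝒞 W x ≤_) (*-identityʳ r) (*-monoʳ-≤ r (ind≤1 (servers 𝒞 x ⊆ᵇ W)))
... | D , fits , covers = ⊥-elim (1+n≰n (begin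
  suc j                                    ≡⟨ ∑μ ⟨
  ∑ μ                                      ≤⟨ ∑-mono μ≤captured*count ⟩
  ∑ (λ x → captured 𝒞 W x * count D x)     ≤⟨ captured-load 𝒞 W D fits ⟩
  Sub.∣ W ∣                                ≡⟨ ∣W∣≡j ⟩
  j                                        ∎))
  where
    open ≤-Reasoning
    μ≤captured*count : ∀ x → μ x ≤ captured 𝒞 W x * count D x
    μ≤captured*count x with servers 𝒞 x ⊆ᵇ W in x-captured
    ... | true = subst (μ x ≤_) (sym (+-identityʳ _)) (covers x)
    ... | false = subst (μ x ≤_) (*-zeroʳ r) (subst (λ b → μ x ≤ r * ind b) x-captured (μ≤r*captured x))

-- Double counting.  Summed over all j-sets of servers, the captured elements
-- number at most ⌊j/r⌋·C(m, j); summed over the elements, they number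
-- Σ_x C(m − deg x, j − deg x).

captures : ∀ {n m} → Code n m → ℕ → Fin n → ℕ
captures {m = m} 𝒞 j x = ∑ₗ (subsets m j) (λ W → captured 𝒞 W x)

captures-total : ∀ {n m} j r .{{_ : NonZero r}} (𝒞 : Code n m) → (∀ μ → Request n (suc j) r μ → Serves 𝒞 μ) →
  ∑ (captures 𝒞 j) ≤ (j / r) * binom m j
captures-total {n} {m} j r 𝒞 serves = begin
  ∑ (captures 𝒞 j)                              ≡⟨ ∑ₗ-∑-comm (subsets m j) (captured 𝒞) ⟨
  ∑ₗ (subsets m j) (∑ ∘ captured 𝒞)             ≤⟨ ∑ₗ-mono (All.map (hall j r 𝒞 serves _) (subsets-size m j)) ⟩
  ∑ₗ (subsets m j) (λ _ → j / r)                ≡⟨ ∑ₗ-const (subsets m j) (j / r) ⟩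
  (j / r) * ∑ₗ (subsets m j) (λ _ → 1)          ≡⟨ cong (j / r *_) (count-subsets m j) ⟩
  (j / r) * binom m j                           ∎
  where open ≤-Reasoning

captures-element : ∀ {n} j t (𝒞 : Code n (suc j + t)) x → deg 𝒞 x ≤ j →
  captures 𝒞 j x ≡ G (suc t) (j ∸ deg 𝒞 x)
captures-element j t 𝒞 x d≤j = begin
  captures 𝒞 j x                                  ≡⟨ supersets (suc j + t) j (servers 𝒞 x) (subst (_≤ j) (sym ∣C∣≡d) d≤j) ⟩
  binom (suc j + t ∸ ∣C∣) (j ∸ ∣C∣)               ≡⟨ cong (λ d → binom (suc j + t ∸ d) (j ∸ d)) ∣C∣≡d ⟩
  binom (suc j + t ∸ d) (j ∸ d)                   ≡⟨ cong (λ z → binom z (j ∸ d)) (trans (cong (_∸ d) (sym (+-suc j t))) (+-∸-comm (suc t) d≤j)) ⟩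
  binom (j ∸ d + suc t) (j ∸ d)                   ∎
  where
    open ≡-Reasoning
    d = deg 𝒞 x
    ∣C∣ = Sub.∣ servers 𝒞 x ∣
    ∣C∣≡d : ∣C∣ ≡ d
    ∣C∣≡d = ∣servers∣≡deg 𝒞 x

double-count : ∀ n c b₀ t r .{{_ : NonZero r}} N (𝒞 : Code n (suc (c + b₀) + t)) →
  IsMCBC n N (suc (c + b₀)) (suc (c + b₀) + t) r 𝒞 →
  n * ((c * suc t + suc b₀) * G (suc t) b₀) ≤
    suc t * G (suc t) b₀ * N + suc b₀ * (((c + b₀) / r) * binom (suc (c + b₀) + t) (c + b₀))
double-count n c b₀ t r N 𝒞 (size≡N , serves) = begin
  n * E                                                   ≡⟨ ∑-const n E ⟨
  ∑[ x < n ] E                                            ≤⟨ ∑-mono per-element ⟩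
  ∑ (λ x → deg 𝒞 x * s * B + suc b₀ * captures 𝒞 j x)      ≡⟨ ∑-distrib-+ (λ x → deg 𝒞 x * s * B) _ ⟩
  ∑ (λ x → deg 𝒞 x * s * B) + ∑ (λ x → suc b₀ * captures 𝒞 j x)
                                                          ≡⟨ cong₂ _+_ (trans (sum-cong-≗ (λ x → trans (*-assoc (deg 𝒞 x) s B) (*-comm (deg 𝒞 x) (s * B)))) (sym (*-distribˡ-sum (s * B) (deg 𝒞))))
                                                                       (sym (*-distribˡ-sum (suc b₀) (captures 𝒞 j))) ⟩
  s * B * ∑ (deg 𝒞) + suc b₀ * ∑ (captures 𝒞 j)            ≡⟨ cong (λ z → s * B * z + suc b₀ * ∑ (captures 𝒞 j)) (trans (sym (size≡∑deg 𝒞)) size≡N) ⟩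
  s * B * N + suc b₀ * ∑ (captures 𝒞 j)                    ≤⟨ +-monoʳ-≤ (s * B * N) (*-monoʳ-≤ (suc b₀) (captures-total j r 𝒞 serves)) ⟩
  s * B * N + suc b₀ * ((j / r) * binom (suc j + t) j)     ∎
  where
    open ≤-Reasoning
    j = c + b₀
    s = suc t
    B = G s b₀
    E = (c * s + suc b₀) * B
    per-element : ∀ x → E ≤ deg 𝒞 x * s * B + suc b₀ * captures 𝒞 j x
    per-element x = element-bound c b₀ s (deg 𝒞 x) (captures 𝒞 j x) (s≤s z≤n) (captures-element j t 𝒞 x)

open import Data.Integer using (+_)

floor-greatest : ∀ z (p : ℚ) → mkℚᵘ z 0 U.≤ ℚ.toℚᵘ p → z ℤ.≤ ℚ.floor p
floor-greatest z (mkℚ num d _) (*≤* z*D≤num) with z ℤ.≤? num ℤ./ + suc d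
... | yes z≤⌊p⌋ = z≤⌊p⌋
... | no z≰⌊p⌋ = ⊥-elim (ZP.<-irrefl refl (ZP.≤-<-trans num≥ (n<s[n/ℕd]*d num (suc d))))
  where
    ⌊p⌋<z : num ℤ./ℕ suc d ℤ.< z
    ⌊p⌋<z = subst (ℤ._< z) (div-pos-is-/ℕ num (suc d)) (ZP.≰⇒> z≰⌊p⌋)
    num≥ : ℤ.suc (num ℤ./ℕ suc d) ℤ.* + suc d ℤ.≤ num
    num≥ = ZP.≤-trans (ZP.*-monoʳ-≤-nonNeg (+ suc d) (ZP.i<j⇒suc[i]≤j ⌊p⌋<z))
             (subst (z ℤ.* + suc d ℤ.≤_) (ZP.*-identityʳ num) z*D≤num)

-- The inequality of natural numbers, rearranged over ℤ with the
-- denominators s = t + 1 and B = B′ + 1 cleared.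
integer-form : ∀ n c N a t T B′ → n * ((c * suc t + a) * suc B′) ≤ suc t * suc B′ * N + a * T →
  (+ (n * c) ℤ.- + N) ℤ.* + (suc t * (suc B′ * 1)) ℤ.≤ (+ a ℤ.* (+ T ℤ.* + 1 ℤ.+ ℤ.- (+ n) ℤ.* + suc B′)) ℤ.* + 1
integer-form n c N a t T B′ h =
  subst₂ ℤ._≤_ (sym lhs≡) (sym rhs≡) (ZP.+-monoˡ-≤ (ℤ.- K) (subst₂ ℤ._≤_ castˡ castʳ (+≤+ h)))
  where
    nᵢ = + n ; cᵢ = + c ; Nᵢ = + N ; aᵢ = + a ; sᵢ = + suc t ; Bᵢ = + suc B′ ; Tᵢ = + T
    K = nᵢ ℤ.* aᵢ ℤ.* Bᵢ ℤ.+ Nᵢ ℤ.* sᵢ ℤ.* Bᵢ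
    castˡ : + (n * ((c * suc t + a) * suc B′)) ≡ nᵢ ℤ.* ((cᵢ ℤ.* sᵢ ℤ.+ aᵢ) ℤ.* Bᵢ)
    castˡ = trans (ZP.pos-* n _) (cong (nᵢ ℤ.*_) (trans (ZP.pos-* (c * suc t + a) (suc B′))
              (cong (ℤ._* Bᵢ) (trans (ZP.pos-+ (c * suc t) a) (cong (ℤ._+ aᵢ) (ZP.pos-* c (suc t)))))))
    castʳ : + (suc t * suc B′ * N + a * T) ≡ sᵢ ℤ.* Bᵢ ℤ.* Nᵢ ℤ.+ aᵢ ℤ.* Tᵢ
    castʳ = trans (ZP.pos-+ (suc t * suc B′ * N) (a * T))
              (cong₂ ℤ._+_ (trans (ZP.pos-* (suc t * suc B′) N) (cong (ℤ._* Nᵢ) (ZP.pos-* (suc t) (suc B′)))) (ZP.pos-* a T))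
    lhs≡ : (+ (n * c) ℤ.- Nᵢ) ℤ.* + (suc t * (suc B′ * 1)) ≡ nᵢ ℤ.* ((cᵢ ℤ.* sᵢ ℤ.+ aᵢ) ℤ.* Bᵢ) ℤ.+ ℤ.- K
    lhs≡ = trans (cong₂ (λ u w → (u ℤ.- Nᵢ) ℤ.* w) (ZP.pos-* n c)
                   (trans (ZP.pos-* (suc t) (suc B′ * 1)) (cong (sᵢ ℤ.*_) (ZP.pos-* (suc B′) 1))))
             (ring nᵢ cᵢ Nᵢ aᵢ sᵢ Bᵢ)
      where
        ring : ∀ n c N a s B → (n ℤ.* c ℤ.- N) ℤ.* (s ℤ.* (B ℤ.* + 1)) ≡
                 n ℤ.* ((c ℤ.* s ℤ.+ a) ℤ.* B) ℤ.+ ℤ.- (n ℤ.* a ℤ.* B ℤ.+ N ℤ.* s ℤ.* B)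
        ring = ZR.solve-∀
    rhs≡ : (aᵢ ℤ.* (Tᵢ ℤ.* + 1 ℤ.+ ℤ.- nᵢ ℤ.* Bᵢ)) ℤ.* + 1 ≡ sᵢ ℤ.* Bᵢ ℤ.* Nᵢ ℤ.+ aᵢ ℤ.* Tᵢ ℤ.+ ℤ.- K
    rhs≡ = ring nᵢ Nᵢ aᵢ sᵢ Bᵢ Tᵢ
      where
        ring : ∀ n N a s B T → (a ℤ.* (T ℤ.* + 1 ℤ.+ ℤ.- n ℤ.* B)) ℤ.* + 1 ≡
                 s ℤ.* B ℤ.* N ℤ.+ a ℤ.* T ℤ.+ ℤ.- (n ℤ.* a ℤ.* B ℤ.+ N ℤ.* s ℤ.* B)
        ring = ZR.solve-∀

-- Dividing by s·B:  n·((c·s + a)·B) ≤ s·B·N + a·T  gives  n·c − N ≤ ⌊ a/s·(T/B − n) ⌋.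
rational-bound : ∀ n c N a t T B′ → n * ((c * suc t + a) * suc B′) ≤ suc t * suc B′ * N + a * T →
  (+ (n * c) ℤ.- + N) ℤ.≤ ℚ.floor (frac a (suc t) ℚ.* (frac T (suc B′) ℚ.- frac n 1))
rational-bound n c N a t T B′ h = floor-greatest _ Q (UP.≤-respʳ-≃ (UP.≃-sym toℚᵘ-Q) (*≤* (integer-form n c N a t T B′ h)))
  where
    Q = frac a (suc t) ℚ.* (frac T (suc B′) ℚ.- frac n 1)
    toℚᵘ-Q : ℚ.toℚᵘ Q U.≃ mkℚᵘ (+ a) t U.* (mkℚᵘ (+ T) B′ U.- mkℚᵘ (+ n) 0)
    toℚᵘ-Q = UP.≃-trans (QP.toℚᵘ-homo-* (frac a (suc t)) _)
      (UP.*-cong (QP.toℚᵘ-fromℚᵘ (mkℚᵘ (+ a) t))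
        (UP.≃-trans (QP.toℚᵘ-homo-+ (frac T (suc B′)) _)
          (UP.+-cong (QP.toℚᵘ-fromℚᵘ (mkℚᵘ (+ T) B′))
            (UP.≃-trans (QP.toℚᵘ-homo‿- (frac n 1)) (UP.-‿cong (QP.toℚᵘ-fromℚᵘ (mkℚᵘ (+ n) 0)))))))

-- Part (v) for k = c + b₀ + 1 and m = k + t.  In boundV, k − c = b₀ + 1,
-- m − k + 1 = t + 1 and C(m − c, k − 1 − c) = G (t+1) b₀, so the bound is
-- `rational-bound` applied to `double-count`.
bound-v-normalised : ∀ n c b₀ t r .{{_ : NonZero r}} N → MCBC n N (suc (c + b₀)) (suc (c + b₀) + t) r →
  boundV n (suc (c + b₀)) (suc (c + b₀) + t) r c ℤ.≤ + N
bound-v-normalised n c b₀ t r N (𝒞 , isMCBC) =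
  subst (λ q → + (n * c) ℤ.- ℚ.floor q ℤ.≤ + N) (sym quotient≡)
    (subst (+ (n * c) ℤ.- ℚ.floor (Φ (suc b₀) (suc t) T (suc B′)) ℤ.≤_) (cancel (+ (n * c)) (+ N))
      (ZP.+-monoʳ-≤ (+ (n * c)) (ZP.neg-mono-≤ (rational-bound n c N (suc b₀) t T B′ counted))))
  where
    k = suc (c + b₀)
    m = k + t
    B = G (suc t) b₀
    B′ = B ∸ 1
    B≡1+B′ : B ≡ suc B′
    B≡1+B′ = sym (m+[n∸m]≡n (binom-pos (b₀ + suc t) b₀ (m≤m+n b₀ (suc t))))
    T = ((c + b₀) / r) * binom m (c + b₀)
    counted : n * ((c * suc t + suc b₀) * suc B′) ≤ suc t * suc B′ * N + suc b₀ * T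
    counted = subst (λ X → n * ((c * suc t + suc b₀) * X) ≤ suc t * X * N + suc b₀ * T) B≡1+B′
                (double-count n c b₀ t r N 𝒞 isMCBC)
    Φ : ℕ → ℕ → ℕ → ℕ → ℚ
    Φ x y u w = frac x y ℚ.* (frac u w ℚ.- frac n 1)
    k∸c : k ∸ c ≡ suc b₀
    k∸c = trans (+-∸-assoc 1 (m≤m+n c b₀)) (cong suc (m+n∸m≡n c b₀))
    m∸k+1 : m ∸ k + 1 ≡ suc t
    m∸k+1 = trans (cong (_+ 1) (m+n∸m≡n k t)) (+-comm t 1)
    numerator : ((k ∸ 1) / r) * (m C (k ∸ 1)) ≡ T
    numerator = cong (((c + b₀) / r) *_) (sym (binom≡C m (c + b₀)))
    m≡c+[b₀+1+t] : ∀ c b₀ t → suc (c + b₀) + t ≡ c + (b₀ + suc t)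
    m≡c+[b₀+1+t] = solve-∀
    denominator : (m ∸ c) C (k ∸ 1 ∸ c) ≡ suc B′
    denominator = trans (cong₂ _C_ (trans (cong (_∸ c) (m≡c+[b₀+1+t] c b₀ t)) (m+n∸m≡n c (b₀ + suc t))) (m+n∸m≡n c b₀))
                    (trans (sym (binom≡C (b₀ + suc t) b₀)) B≡1+B′)
    quotient≡ : Φ (k ∸ c) (m ∸ k + 1) (((k ∸ 1) / r) * (m C (k ∸ 1))) ((m ∸ c) C (k ∸ 1 ∸ c)) ≡ Φ (suc b₀) (suc t) T (suc B′)
    quotient≡ = trans (cong₂ (λ x y → Φ x y (((k ∸ 1) / r) * (m C (k ∸ 1))) ((m ∸ c) C (k ∸ 1 ∸ c))) k∸c m∸k+1)
                      (cong₂ (Φ (suc b₀) (suc t)) numerator denominator)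
    cancel : ∀ i N → i ℤ.+ ℤ.- (i ℤ.- N) ≡ N
    cancel = ZR.solve-∀

bound-v : ∀ n k m r .{{_ : NonZero r}} → r ≤ k → k ≤ m →
  ∀ c → c ≤ k ∸ 1 → ∀ N → MCBC n N k m r → boundV n k m r c ℤ.≤ + N
bound-v n k m r r≤k k≤m c c≤k-1 =
  subst (Bound k) (m+[n∸m]≡n k≤m) (subst (λ K → Bound K (K + (m ∸ k))) k≡ (bound-v-normalised n c (k ∸ 1 ∸ c) (m ∸ k) r))
  where
    Bound : ℕ → ℕ → Set
    Bound K M = ∀ N → MCBC n N K M r → boundV n K M r c ℤ.≤ + N
    k≡ : suc (c + (k ∸ 1 ∸ c)) ≡ k
    k≡ = trans (cong suc (m+[n∸m]≡n c≤k-1)) (m+[n∸m]≡n (≤-trans (>-nonZero⁻¹ r) r≤k))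

theorem2 : (n k m r : ℕ) → .{{_ : NonZero r}} → 0 < n → r ≤ k → k ≤ m → k ≤ r * n →
    -- (i) N(n,k,m;r) ≥ r n
    (∀ N → MCBC n N k m r → r * n ≤ N)
    -- (ii) N(n,k,m;r) ≥ N(n,k,m;i) for i ∈ [r−1]
  × (∀ i → 1 ≤ i → i < r → ∀ N → MCBC n N k m r → ∃ λ N′ → N′ ≤ N × MCBC n N′ k m i)
    -- (iii) lower: N(rn,k,m) ≤ r N(n,k,m;r)
  × (∀ N → MCBC n N k m r → ∃ λ N′ → N′ ≤ r * N × MCBC (r * n) N′ k m 1)
    -- (iii) upper: N(n,k,m;r) ≤ N(rn,k,m)
  × (∀ N → MCBC (r * n) N k m 1 → ∃ λ N′ → N′ ≤ N × MCBC n N′ k m r)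
    -- (iv) N(n,k,m;r) ≤ r N(n,⌈k/r⌉,⌊m/r⌋)
  × (∀ N → MCBC n N ⌈ k / r ⌉ (m / r) 1 → ∃ λ N′ → N′ ≤ r * N × MCBC n N′ k m r)
    -- (v) if r ≤ k−1, for all c ∈ [r, k−1], N(n,k,m;r) ≥ boundV
  × (r ≤ k ∸ 1 → ∀ c → r ≤ c → c ≤ k ∸ 1 → ∀ N → MCBC n N k m r → boundV n k m r c ℤ.≤ + N)
theorem2 n k m r _ r≤k k≤m k≤rn =
    size≥rn n k m r r≤k k≤rn
  , (λ i _ i<r N code → N , ≤-refl , lower-multiplicity (<⇒≤ i<r) code)
  , blowUp-MCBC n k m r
  , project-MCBC n k m r
  , replicate-MCBC n k m r k≤rn
  , λ _ c _ c≤k-1 → bound-v n k m r r≤k k≤m c c≤k-1
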